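{- Let $S=\{i_1,i_2,\ldots,i_s\}\subseteq[n+1]$ with $i_1<i_2<\cdots<i_s$ be an $(n+1)$-admissible set. For $1\le \ell\le s$ let $S_{i_\ell}=\{i_1,\ldots,i_{\ell-1},i_\ell-1,i_{\ell+1}-1,\ldots,i_s-1\}$ and $\widehat{S}_{i_\ell}=\{i_1,\ldots,i_{\ell-1},i_{\ell+1}-1,\ldots,i_s-1\}$ (i.e. $S_{i_\ell}$ with the element $i_\ell-1$ removed). Then the following equality of polynomials holds: \[(\Delta p_S)(x)=\sum_{\ell=1}^{s}p_{S_{i_\ell}}(x)+\sum_{\ell=1}^{s}p_{\widehat{S}_{i_\ell}}(x).\]
   Context: For a positive integer $n$, $[n]=\{1,\dots,n\}$ and $\mathfrak{S}_n$ is the symmetric group, with $\pi\in\mathfrak{S}_n$ written in one-line notation $\pi=\pi_1\cdots\pi_n$. A permutation $\pi$ has a peak at index $i$ (necessarily $2\le i\le n-1$) if $\pi_{i-1}<\pi_i>\pi_{i+1}$; $\mathcal{P}(\pi)$ is the set of such indices. For a set $T$ of positive integers, $\mathcal{P}_T(q)=\{\pi\in\mathfrak{S}_q:\mathcal{P}(\pi)=T\}$, and $T$ is $q$-admissible if $\mathcal{P}_T(q)\ne\emptyset$. By a result of Billey, Burdzy and Sagan, for each set $T$ admissible for some $q$ there is a polynomial $p_T(x)$ (the peak polynomial of $T$) with $|\mathcal{P}_T(q)|=p_T(q)\,2^{q-|T|-1}$ for every $q$ for which $T$ is $q$-admissible (e.g. $p_\emptyset=1$). If $T$ is not $q$-admissible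 for any $q$ (e.g. $T$ contains two consecutive integers or contains $1$), then $p_T$ is taken to be the zero polynomial. The forward difference operator is $(\Delta f)(x)=f(x+1)-f(x)$. -}

module Defs where

open import Data.Nat as ℕ using (ℕ; zero; suc; _∸_; _^_)
open import Data.Integer using (+_)
open import Data.Rational as ℚ using (ℚ; _/_; 0ℚ)
open import Data.List using (List; []; _∷_; length; map; upTo; take; drop; foldr; _++_)
open import Data.List.Membership.Propositional using (_∈_)
open import Data.List.Relation.Unary.All using (All)
open import Data.List.Relation.Unary.Unique.Propositional using (Unique)
open import Data.List.Relation.Binary.Permutation.Propositional using (_↭_)
open import Data.Product using (Σ; ∃; _×_)
open import Relation.Binary.PropositionalEquality using (_≡_)

ℕ→ℚ : ℕ → ℚ
ℕ→ℚ n = (+ n) / 1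

-- 1-based indexing into a list (default 0 outside range; only used in range)
nth : List ℕ → ℕ → ℕ
nth []       _             = 0
nth (x ∷ xs) zero          = 0
nth (x ∷ xs) (suc zero)    = x
nth (x ∷ xs) (suc (suc i)) = nth xs (suc i)

-- a permutation of [q] in one-line notation: a rearrangement of 1,...,q
IsPerm : ℕ → List ℕ → Set
IsPerm q π = π ↭ map suc (upTo q)

IsPeak : List ℕ → ℕ → Set
IsPeak π i = (2 ℕ.≤ i) × (suc i ℕ.≤ length π)
           × (nth π (i ∸ 1) ℕ.< nth π i) × (nth π (suc i) ℕ.< nth π i)

PeakSetIs : List ℕ → List ℕ → Set
PeakSetIs π T = ∀ i → (i ∈ T → IsPeak π i) × (IsPeak π i → i ∈ T)

Admissible : List ℕ → ℕ → Set
Admissible T q = ∃ λ π → IsPerm q π × PeakSetIs π T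

-- |𝒫_T(q)| = c : there is a duplicate-free list enumerating exactly 𝒫_T(q), of length c
HasCount : List ℕ → ℕ → ℕ → Set
HasCount T q c = Σ (List (List ℕ)) λ L →
  Unique L × All (λ π → IsPerm q π × PeakSetIs π T) L
  × (∀ π → IsPerm q π → PeakSetIs π T → π ∈ L) × (length L ≡ c)

-- polynomials over ℚ as coefficient lists (constant term first)
Poly : Set
Poly = List ℚ

eval : Poly → ℚ → ℚ
eval p x = foldr (λ a acc → a ℚ.+ x ℚ.* acc) 0ℚ p

Δeval : Poly → ℚ → ℚ
Δeval p x = eval p (x ℚ.+ ℕ→ℚ 1) ℚ.- eval p x

-- p is the peak polynomial of T (T a strictly increasing list, so |T| = length T):
-- |𝒫_T(q)| = p(q) 2^{q-|T|-1} whenever T is q-admissible, and p = 0 if T is never admissible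
IsPeakPoly : List ℕ → Poly → Set
IsPeakPoly T p =
  (∀ q c → Admissible T q → HasCount T q c →
     ℕ→ℚ c ≡ eval p (ℕ→ℚ q) ℚ.* ℕ→ℚ (2 ^ (q ∸ length T ∸ 1)))
  × ((∀ q → Admissible T q → Data.Empty.⊥) → ∀ x → eval p x ≡ 0ℚ)
  where import Data.Empty

-- for 0-based ℓ (ℓ = 0..s-1), S_{i_{ℓ+1}} and Ŝ_{i_{ℓ+1}}
Sℓ : List ℕ → ℕ → List ℕ
Sℓ S ℓ = take ℓ S ++ map (_∸ 1) (drop ℓ S)

Ŝℓ : List ℕ → ℕ → List ℕ
Ŝℓ S ℓ = take ℓ S ++ map (_∸ 1) (drop (suc ℓ) S)

sumℚ : ℕ → (ℕ → ℚ) → ℚ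
sumℚ s f = foldr ℚ._+_ 0ℚ (map f (upTo s))

-- Let N_T(q) = |𝒫_T(q)|. Every permutation of [q + 1] arises from one of [q] by inserting the maximum
-- q + 1 into a gap g, and the peak set changes predictably: at the front all peaks move up by one, at the
-- end nothing changes, and in an interior gap g + 1 becomes a peak, the peaks right of it move up by one,
-- and a peak at g or g + 1 is destroyed. Sorting by the gap therefore gives the recursion
--   N_S(q + 1) = 2 N_S(q) + 2 Σ_ℓ N_{S_ℓ}(q) + Σ_ℓ N_{Ŝ_ℓ}(q).
-- Substituting N_T(q) = p_T(q) 2^{q - |T| - 1} (|S_ℓ| = s, |Ŝ_ℓ| = s - 1) and dividing by 2^{q - s} yields
-- the claimed difference equation at every large integer q, hence as an identity of polynomials.
-- Which of the sets involved are admissible is only known classically, so the argument runs under a double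
-- negation, removed at the end because equality of rationals is decidable.

module Submission where

module Counting where

  open import Data.Nat using (ℕ; zero; suc; _+_; _<_; _≟_; z≤n; s≤s)
  import Data.Nat.Properties as ℕₚ
  open import Data.Nat.Tactic.RingSolver using (solve-∀)
  open import Data.List using (List; []; _∷_; _++_; map; length; filter)
  open import Data.List.Membership.Propositional using (_∈_)
  open import Data.List.Relation.Unary.Any using (here; there)
  open import Data.Sum using (_⊎_; [_,_])
  open import Function using (_∘_)
  open import Relation.Binary.PropositionalEquality
  open import Relation.Nullary using (¬_; Dec; yes; no; contradiction)
  open import Relation.Unary using (Decidable)

  ∑ : ℕ → (ℕ → ℕ) → ℕ
  ∑ zero    f = 0
  ∑ (suc n) f = f 0 + ∑ n (f ∘ suc)

  ∑-cong : ∀ n {f h} → (∀ g → g < n → f g ≡ h g) → ∑ n f ≡ ∑ n h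
  ∑-cong zero    eq = refl
  ∑-cong (suc n) eq = cong₂ _+_ (eq 0 (s≤s z≤n)) (∑-cong n (λ g g<n → eq (suc g) (s≤s g<n)))

  ∑-zero : ∀ n {f} → (∀ g → g < n → f g ≡ 0) → ∑ n f ≡ 0
  ∑-zero zero    eq = refl
  ∑-zero (suc n) eq = cong₂ _+_ (eq 0 (s≤s z≤n)) (∑-zero n (λ g g<n → eq (suc g) (s≤s g<n)))

  ∑-+ : ∀ n f h → ∑ n (λ g → f g + h g) ≡ ∑ n f + ∑ n h
  ∑-+ zero    f h = refl
  ∑-+ (suc n) f h rewrite ∑-+ n (f ∘ suc) (h ∘ suc) = interchange (f 0) (h 0) _ _
    where
    interchange : ∀ a b c d → a + b + (c + d) ≡ a + c + (b + d)
    interchange = solve-∀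

  ∑-last : ∀ n f → ∑ (suc n) f ≡ ∑ n f + f n
  ∑-last zero    f = ℕₚ.+-comm (f 0) 0
  ∑-last (suc n) f = trans (cong (f 0 +_) (∑-last n (f ∘ suc))) (sym (ℕₚ.+-assoc (f 0) _ _))

  ∑-swap : ∀ n m (f : ℕ → ℕ → ℕ) → ∑ n (λ g → ∑ m (f g)) ≡ ∑ m (λ l → ∑ n (λ g → f g l))
  ∑-swap zero    m f = sym (∑-zero m (λ _ _ → refl))
  ∑-swap (suc n) m f = trans (cong (∑ m (f 0) +_) (∑-swap n m (f ∘ suc)))
                             (sym (∑-+ m (f 0) (λ l → ∑ n (λ g → f (suc g) l))))

  δ : ℕ → ℕ → ℕ → ℕ
  δ a b y with a ≟ b
  ... | yes _ = y
  ... | no  _ = 0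

  δ-≡ : ∀ {a b} y → a ≡ b → δ a b y ≡ y
  δ-≡ {a} {b} y a≡b with a ≟ b
  ... | yes _   = refl
  ... | no  a≢b = contradiction a≡b a≢b

  δ-≢ : ∀ {a b} y → ¬ a ≡ b → δ a b y ≡ 0
  δ-≢ {a} {b} y a≢b with a ≟ b
  ... | yes a≡b = contradiction a≡b a≢b
  ... | no  _   = refl

  δ-suc : ∀ a b y → δ (suc a) (suc b) y ≡ δ a b y
  δ-suc a b y with a ≟ b
  ... | yes a≡b = δ-≡ y (cong suc a≡b)
  ... | no  a≢b = δ-≢ y (a≢b ∘ ℕₚ.suc-injective)

  δ-sym : ∀ a b y → δ a b y ≡ δ b a y
  δ-sym a b y with a ≟ b
  ... | yes a≡b = sym (δ-≡ y (sym a≡b))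
  ... | no  a≢b = sym (δ-≢ y (a≢b ∘ sym))

  ∑-δ : ∀ m l₀ (y : ℕ → ℕ) → l₀ < m → ∑ m (λ l → δ l l₀ (y l)) ≡ y l₀
  ∑-δ (suc m) zero y _ = begin
    y 0 + ∑ m (λ l → δ (suc l) 0 (y (suc l)))  ≡⟨ cong (y 0 +_) (∑-zero m (λ l _ → δ-≢ {suc l} {0} (y (suc l)) λ ())) ⟩
    y 0 + 0                                   ≡⟨ ℕₚ.+-identityʳ (y 0) ⟩
    y 0                                       ∎
    where open ≡-Reasoning
  ∑-δ (suc m) (suc l₀) y (s≤s l₀<m) = begin
    δ 0 (suc l₀) (y 0) + rest           ≡⟨ cong (_+ rest) (δ-≢ {0} {suc l₀} (y 0) λ ()) ⟩
    rest                                ≡⟨ ∑-cong m (λ l _ → δ-suc l l₀ (y (suc l))) ⟩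
    ∑ m (λ l → δ l l₀ (y (suc l)))      ≡⟨ ∑-δ m l₀ (y ∘ suc) l₀<m ⟩
    y (suc l₀)                          ∎
    where
    open ≡-Reasoning
    rest = ∑ m (λ l → δ (suc l) (suc l₀) (y (suc l)))

  ⟦_⟧ : ∀ {P : Set} → Dec P → ℕ
  ⟦ yes _ ⟧ = 1
  ⟦ no  _ ⟧ = 0

  ⟦⟧-yes : ∀ {P : Set} (P? : Dec P) → P → ⟦ P? ⟧ ≡ 1
  ⟦⟧-yes (yes _) _ = refl
  ⟦⟧-yes (no ¬p) p = contradiction p ¬p

  ⟦⟧-no : ∀ {P : Set} (P? : Dec P) → ¬ P → ⟦ P? ⟧ ≡ 0
  ⟦⟧-no (yes p) ¬p = contradiction p ¬p
  ⟦⟧-no (no _)  _  = refl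

  ⟦⟧-⇔ : ∀ {P Q : Set} (P? : Dec P) (Q? : Dec Q) → (P → Q) → (Q → P) → ⟦ P? ⟧ ≡ ⟦ Q? ⟧
  ⟦⟧-⇔ P? (yes q) _   Q→P = ⟦⟧-yes P? (Q→P q)
  ⟦⟧-⇔ P? (no ¬q) P→Q _   = ⟦⟧-no P? (¬q ∘ P→Q)

  ⟦⟧-⊎₃ : ∀ {P Q₁ Q₂ Q₃ : Set} (P? : Dec P) (Q₁? : Dec Q₁) (Q₂? : Dec Q₂) (Q₃? : Dec Q₃) →
          (P → Q₁ ⊎ Q₂ ⊎ Q₃) → (Q₁ → P) → (Q₂ → P) → (Q₃ → P) →
          (Q₁ → ¬ Q₂) → (Q₁ → ¬ Q₃) → (Q₂ → ¬ Q₃) →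
          ⟦ P? ⟧ ≡ ⟦ Q₁? ⟧ + ⟦ Q₂? ⟧ + ⟦ Q₃? ⟧
  ⟦⟧-⊎₃ P? (yes q₁) (yes q₂) _        _ _  _  _  ¬₁₂ _   _   = contradiction q₂ (¬₁₂ q₁)
  ⟦⟧-⊎₃ P? (yes q₁) (no _)   (yes q₃) _ _  _  _  _   ¬₁₃ _   = contradiction q₃ (¬₁₃ q₁)
  ⟦⟧-⊎₃ P? (yes q₁) (no _)   (no _)   _ f₁ _  _  _   _   _   = ⟦⟧-yes P? (f₁ q₁)
  ⟦⟧-⊎₃ P? (no _)   (yes q₂) (yes q₃) _ _  _  _  _   _   ¬₂₃ = contradiction q₃ (¬₂₃ q₂)
  ⟦⟧-⊎₃ P? (no _)   (yes q₂) (no _)   _ _  f₂ _  _   _   _   = ⟦⟧-yes P? (f₂ q₂)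
  ⟦⟧-⊎₃ P? (no _)   (no _)   (yes q₃) _ _  _  f₃ _   _   _   = ⟦⟧-yes P? (f₃ q₃)
  ⟦⟧-⊎₃ P? (no ¬q₁) (no ¬q₂) (no ¬q₃) t _  _  _  _   _   _   = ⟦⟧-no P? ([ ¬q₁ , [ ¬q₂ , ¬q₃ ] ] ∘ t)

  module _ {A : Set} where

    count : {P : A → Set} → Decidable P → List A → ℕ
    count P? = length ∘ filter P?

    count-∷ : {P : A → Set} (P? : Decidable P) → ∀ x xs → count P? (x ∷ xs) ≡ ⟦ P? x ⟧ + count P? xs
    count-∷ P? x xs with P? x
    ... | yes _ = refl
    ... | no  _ = refl

    count-++ : {P : A → Set} (P? : Decidable P) → ∀ xs ys → count P? (xs ++ ys) ≡ count P? xs + count P? ys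
    count-++ P? []       ys = refl
    count-++ P? (x ∷ xs) ys = begin
      count P? (x ∷ xs ++ ys)               ≡⟨ count-∷ P? x (xs ++ ys) ⟩
      ⟦ P? x ⟧ + count P? (xs ++ ys)        ≡⟨ cong (⟦ P? x ⟧ +_) (count-++ P? xs ys) ⟩
      ⟦ P? x ⟧ + (count P? xs + count P? ys) ≡⟨ ℕₚ.+-assoc ⟦ P? x ⟧ _ _ ⟨
      ⟦ P? x ⟧ + count P? xs + count P? ys  ≡⟨ cong (_+ count P? ys) (count-∷ P? x xs) ⟨
      count P? (x ∷ xs) + count P? ys       ∎
      where open ≡-Reasoning

    count-map : {P : A → Set} (P? : Decidable P) (h : A → A) → ∀ xs → count P? (map h xs) ≡ count (P? ∘ h) xs
    count-map P? h []       = refl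
    count-map P? h (x ∷ xs) = trans (count-∷ P? (h x) (map h xs))
      (trans (cong (⟦ P? (h x) ⟧ +_) (count-map P? h xs)) (sym (count-∷ (P? ∘ h) x xs)))

    count-none : {P : A → Set} (P? : Decidable P) → ∀ xs → (∀ x → x ∈ xs → ¬ P x) → count P? xs ≡ 0
    count-none P? []       _    = refl
    count-none P? (x ∷ xs) none = trans (count-∷ P? x xs)
      (cong₂ _+_ (⟦⟧-no (P? x) (none x (here refl))) (count-none P? xs (λ y → none y ∘ there)))

    count-cong : {P Q : A → Set} (P? : Decidable P) (Q? : Decidable Q) → ∀ xs →
                 (∀ x → x ∈ xs → ⟦ P? x ⟧ ≡ ⟦ Q? x ⟧) → count P? xs ≡ count Q? xs
    count-cong P? Q? []       _  = refl
    count-cong P? Q? (x ∷ xs) eq = trans (count-∷ P? x xs)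
      (trans (cong₂ _+_ (eq x (here refl)) (count-cong P? Q? xs (λ y → eq y ∘ there))) (sym (count-∷ Q? x xs)))

    count-+₃ : {P Q₁ Q₂ Q₃ : A → Set} (P? : Decidable P) (Q₁? : Decidable Q₁) (Q₂? : Decidable Q₂) (Q₃? : Decidable Q₃) →
               ∀ xs → (∀ x → x ∈ xs → ⟦ P? x ⟧ ≡ ⟦ Q₁? x ⟧ + ⟦ Q₂? x ⟧ + ⟦ Q₃? x ⟧) →
               count P? xs ≡ count Q₁? xs + count Q₂? xs + count Q₃? xs
    count-+₃ P? Q₁? Q₂? Q₃? []       _  = refl
    count-+₃ P? Q₁? Q₂? Q₃? (x ∷ xs) eq
      rewrite count-∷ P? x xs | count-∷ Q₁? x xs | count-∷ Q₂? x xs | count-∷ Q₃? x xs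
            | eq x (here refl) | count-+₃ P? Q₁? Q₂? Q₃? xs (λ y → eq y ∘ there)
            = interchange ⟦ Q₁? x ⟧ ⟦ Q₂? x ⟧ ⟦ Q₃? x ⟧ _ _ _
      where
      interchange : ∀ a b c d e f → a + b + c + (d + e + f) ≡ a + d + (b + e) + (c + f)
      interchange = solve-∀


module Polynomial where

  open import Data.Nat as ℕ using (ℕ; zero; suc; _^_; _<_; _≤_; z≤n; s≤s)
  import Data.Nat.Properties as ℕₚ
  import Data.Integer.Properties as ℤₚ
  open import Data.Rational as ℚ using (ℚ; 0ℚ; 1ℚ; _+_; _*_; _-_; -_; 1/_)
  import Data.Rational.Properties as ℚₚ
  open import Data.Nat.Coprimality using (1-coprimeTo)
  import Data.Nat.Coprimality as Coprime
  open import Data.List using ([]; _∷_; length; map; foldr)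
  import Data.List.Properties as Listₚ
  open import Function using (_∘_)
  open import Algebra.Properties.Group ℚₚ.+-0-group using (x∙y⁻¹≈ε⇒x≈y)
  open import Relation.Binary.PropositionalEquality
  open import Relation.Nullary using (¬_)
  open import Relation.Nullary.Decidable using (dec⇒maybe)
  open import Tactic.RingSolver using (solve-∀)
  open import Tactic.RingSolver.Core.AlmostCommutativeRing using (AlmostCommutativeRing; fromCommutativeRing)
  open import Defs
  open Counting using (∑)

  ℚ-ring : AlmostCommutativeRing _ _
  ℚ-ring = fromCommutativeRing ℚₚ.+-*-commutativeRing (λ x → dec⇒maybe (0ℚ ℚ.≟ x))

  ℕ→ℚ-suc : ∀ n → ℕ→ℚ (suc n) ≡ 1ℚ + ℕ→ℚ n
  ℕ→ℚ-suc n rewrite ℚₚ.normalize-coprime (Coprime.sym (1-coprimeTo n))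
                  | ℕₚ.*-identityʳ n | ℤₚ.+◃n≡+n n = refl

  ℕ→ℚ-+ : ∀ m n → ℕ→ℚ (m ℕ.+ n) ≡ ℕ→ℚ m + ℕ→ℚ n
  ℕ→ℚ-+ zero    n = sym (ℚₚ.+-identityˡ (ℕ→ℚ n))
  ℕ→ℚ-+ (suc m) n = begin
    ℕ→ℚ (suc (m ℕ.+ n))          ≡⟨ ℕ→ℚ-suc (m ℕ.+ n) ⟩
    1ℚ + ℕ→ℚ (m ℕ.+ n)           ≡⟨ cong (1ℚ +_) (ℕ→ℚ-+ m n) ⟩
    1ℚ + (ℕ→ℚ m + ℕ→ℚ n)         ≡⟨ ℚₚ.+-assoc 1ℚ (ℕ→ℚ m) (ℕ→ℚ n) ⟨
    (1ℚ + ℕ→ℚ m) + ℕ→ℚ n         ≡⟨ cong (_+ ℕ→ℚ n) (ℕ→ℚ-suc m) ⟨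
    ℕ→ℚ (suc m) + ℕ→ℚ n          ∎
    where open ≡-Reasoning

  ℕ→ℚ-injective : ∀ {m n} → ℕ→ℚ m ≡ ℕ→ℚ n → m ≡ n
  ℕ→ℚ-injective {m} {n} eq
    rewrite ℚₚ.normalize-coprime (Coprime.sym (1-coprimeTo m))
          | ℚₚ.normalize-coprime (Coprime.sym (1-coprimeTo n))
    = ℤₚ.+-injective (cong ℚ.numerator eq)

  ℕ→ℚ-2^-suc : ∀ k → ℕ→ℚ (2 ^ suc k) ≡ ℕ→ℚ (2 ^ k) + ℕ→ℚ (2 ^ k)
  ℕ→ℚ-2^-suc k = trans (cong (ℕ→ℚ ∘ (2 ^ k ℕ.+_)) (ℕₚ.+-identityʳ (2 ^ k))) (ℕ→ℚ-+ (2 ^ k) (2 ^ k))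

  ℕ→ℚ-2^≢0 : ∀ k → ¬ ℕ→ℚ (2 ^ k) ≡ 0ℚ
  ℕ→ℚ-2^≢0 k eq = ℕₚ.<⇒≢ (ℕₚ.m^n>0 2 k) (sym (ℕ→ℚ-injective eq))

  *-cancelˡ-≢0 : ∀ t {a b} → ¬ t ≡ 0ℚ → t * a ≡ t * b → a ≡ b
  *-cancelˡ-≢0 t {a} {b} t≢0 eq = begin
    a                 ≡⟨ ℚₚ.*-identityˡ a ⟨
    1ℚ * a            ≡⟨ cong (_* a) (ℚₚ.*-inverseˡ t) ⟨
    1/ t * t * a      ≡⟨ ℚₚ.*-assoc (1/ t) t a ⟩
    1/ t * (t * a)    ≡⟨ cong (1/ t *_) eq ⟩
    1/ t * (t * b)    ≡⟨ ℚₚ.*-assoc (1/ t) t b ⟨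
    1/ t * t * b      ≡⟨ cong (_* b) (ℚₚ.*-inverseˡ t) ⟩
    1ℚ * b            ≡⟨ ℚₚ.*-identityˡ b ⟩
    b                 ∎
    where
    open ≡-Reasoning
    instance _ = ℚ.≢-nonZero t≢0

  infixl 6 _⊕_

  _⊕_ : Poly → Poly → Poly
  []      ⊕ q       = q
  (a ∷ p) ⊕ []      = a ∷ p
  (a ∷ p) ⊕ (b ∷ q) = (a + b) ∷ (p ⊕ q)

  eval-⊕ : ∀ p q x → eval (p ⊕ q) x ≡ eval p x + eval q x
  eval-⊕ []      q       x = sym (ℚₚ.+-identityˡ _)
  eval-⊕ (a ∷ p) []      x = sym (ℚₚ.+-identityʳ _)
  eval-⊕ (a ∷ p) (b ∷ q) x rewrite eval-⊕ p q x = distrib a b x (eval p x) (eval q x)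
    where
    distrib : ∀ a b x u v → a + b + x * (u + v) ≡ a + x * u + (b + x * v)
    distrib = solve-∀ ℚ-ring

  length-⊕ : ∀ {k} p q → length p ≤ k → length q ≤ k → length (p ⊕ q) ≤ k
  length-⊕          []      q       _         q≤k       = q≤k
  length-⊕          (a ∷ p) []      p≤k       _         = p≤k
  length-⊕ {suc k} (a ∷ p) (b ∷ q) (s≤s p≤k) (s≤s q≤k) = s≤s (length-⊕ p q p≤k q≤k)

  scale : ℚ → Poly → Poly
  scale c = map (c *_)

  eval-scale : ∀ c p x → eval (scale c p) x ≡ c * eval p x
  eval-scale c []      x = sym (ℚₚ.*-zeroʳ c)
  eval-scale c (a ∷ p) x rewrite eval-scale c p x = distrib c a x (eval p x)
    where
    distrib : ∀ c a x u → c * a + x * (c * u) ≡ c * (a + x * u)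
    distrib = solve-∀ ℚ-ring

  -- (a ∷ p)(x + 1) = a + x · p(x + 1) + p(x + 1)
  shift : Poly → Poly
  shift []      = []
  shift (a ∷ p) = (a ∷ []) ⊕ ((0ℚ ∷ shift p) ⊕ shift p)

  eval-shift : ∀ p x → eval (shift p) x ≡ eval p (x + 1ℚ)
  eval-shift []      x = refl
  eval-shift (a ∷ p) x
    rewrite eval-⊕ (a ∷ []) ((0ℚ ∷ shift p) ⊕ shift p) x
          | eval-⊕ (0ℚ ∷ shift p) (shift p) x
          | eval-shift p x
          = horner a x (eval p (x + 1ℚ))
    where
    horner : ∀ a x u → a + x * 0ℚ + (0ℚ + x * u + u) ≡ a + (x + 1ℚ) * u
    horner = solve-∀ ℚ-ring

  negate : Poly → Poly
  negate = map (λ a → - a)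

  eval-negate : ∀ p x → eval (negate p) x ≡ - eval p x
  eval-negate []      x = refl
  eval-negate (a ∷ p) x rewrite eval-negate p x = negation a x (eval p x)
    where
    negation : ∀ a x u → - a + x * - u ≡ - (a + x * u)
    negation = solve-∀ ℚ-ring

  quotient : ℚ → Poly → Poly
  quotient r []      = []
  quotient r (a ∷ p) = p ⊕ scale r (quotient r p)

  length-quotient : ∀ r a p → length (quotient r (a ∷ p)) ≤ length p
  length-quotient r a p =
    length-⊕ p _ ℕₚ.≤-refl (ℕₚ.≤-trans (ℕₚ.≤-reflexive (Listₚ.length-map _ (quotient r p))) (bound p))
    where
    bound : ∀ p → length (quotient r p) ≤ length p
    bound []      = z≤n
    bound (a ∷ p) = ℕₚ.m≤n⇒m≤1+n (length-quotient r a p)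

  remainder-theorem : ∀ r p x → eval p x ≡ (x - r) * eval (quotient r p) x + eval p r
  remainder-theorem r []      x = sym (trans (cong (_+ 0ℚ) (ℚₚ.*-zeroʳ (x - r))) (ℚₚ.+-identityʳ 0ℚ))
  remainder-theorem r (a ∷ p) x
    rewrite eval-⊕ p (scale r (quotient r p)) x
          | eval-scale r (quotient r p) x
          | remainder-theorem r p x
          = division a x r (eval (quotient r p) x) (eval p r)
    where
    division : ∀ a x r Q R → a + x * ((x - r) * Q + R) ≡ (x - r) * ((x - r) * Q + R + r * Q) + (a + r * R)
    division = solve-∀ ℚ-ring

  -- Induction on the number of coefficients: dividing out x - Q leaves a quotient that vanishes from Q + 1 on.
  eventually-zero⇒zero : ∀ p Q → (∀ q → Q ≤ q → eval p (ℕ→ℚ q) ≡ 0ℚ) → ∀ x → eval p x ≡ 0ℚ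
  eventually-zero⇒zero p Q = bounded (length p) p Q ℕₚ.≤-refl
    where
    bounded : ∀ k p Q → length p ≤ k → (∀ q → Q ≤ q → eval p (ℕ→ℚ q) ≡ 0ℚ) → ∀ x → eval p x ≡ 0ℚ
    bounded k       []      Q _         _    x = refl
    bounded (suc k) (a ∷ p) Q (s≤s p≤k) vanish x = begin
      eval (a ∷ p) x                     ≡⟨ remainder-theorem r (a ∷ p) x ⟩
      (x - r) * eval Quo x + eval (a ∷ p) r ≡⟨ cong₂ (λ u v → (x - r) * u + v) (Quo-zero x) (vanish Q ℕₚ.≤-refl) ⟩
      (x - r) * 0ℚ + 0ℚ                  ≡⟨ cong (_+ 0ℚ) (ℚₚ.*-zeroʳ (x - r)) ⟩
      0ℚ                                 ∎
      where
      open ≡-Reasoning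
      r = ℕ→ℚ Q
      Quo = quotient r (a ∷ p)

      Quo-zero-from : ∀ q → suc Q ≤ q → eval Quo (ℕ→ℚ q) ≡ 0ℚ
      Quo-zero-from q Q<q = *-cancelˡ-≢0 (ℕ→ℚ q - r) q-r≢0 (begin
        (ℕ→ℚ q - r) * eval Quo (ℕ→ℚ q)                  ≡⟨ ℚₚ.+-identityʳ ((ℕ→ℚ q - r) * eval Quo (ℕ→ℚ q)) ⟨
        (ℕ→ℚ q - r) * eval Quo (ℕ→ℚ q) + 0ℚ             ≡⟨ cong ((ℕ→ℚ q - r) * eval Quo (ℕ→ℚ q) +_) (vanish Q ℕₚ.≤-refl) ⟨
        (ℕ→ℚ q - r) * eval Quo (ℕ→ℚ q) + eval (a ∷ p) r ≡⟨ remainder-theorem r (a ∷ p) (ℕ→ℚ q) ⟨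
        eval (a ∷ p) (ℕ→ℚ q)                            ≡⟨ vanish q (ℕₚ.<⇒≤ Q<q) ⟩
        0ℚ                                              ≡⟨ ℚₚ.*-zeroʳ (ℕ→ℚ q - r) ⟨
        (ℕ→ℚ q - r) * 0ℚ                                ∎)
        where
        q-r≢0 : ¬ ℕ→ℚ q - r ≡ 0ℚ
        q-r≢0 eq = ℕₚ.<⇒≢ Q<q (sym (ℕ→ℚ-injective (x∙y⁻¹≈ε⇒x≈y _ _ eq)))

      Quo-zero : ∀ x → eval Quo x ≡ 0ℚ
      Quo-zero = bounded k Quo (suc Q) (ℕₚ.≤-trans (length-quotient r a p) p≤k) Quo-zero-from

  eventually-equal⇒equal : ∀ p p′ Q → (∀ q → Q ≤ q → eval p (ℕ→ℚ q) ≡ eval p′ (ℕ→ℚ q)) →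
                           ∀ x → eval p x ≡ eval p′ x
  eventually-equal⇒equal p p′ Q agree x = x∙y⁻¹≈ε⇒x≈y _ _ (begin
    eval p x - eval p′ x              ≡⟨ cong (eval p x +_) (eval-negate p′ x) ⟨
    eval p x + eval (negate p′) x     ≡⟨ eval-⊕ p (negate p′) x ⟨
    eval (p ⊕ negate p′) x            ≡⟨ eventually-zero⇒zero (p ⊕ negate p′) Q difference-zero x ⟩
    0ℚ                                ∎)
    where
    open ≡-Reasoning
    difference-zero : ∀ q → Q ≤ q → eval (p ⊕ negate p′) (ℕ→ℚ q) ≡ 0ℚ
    difference-zero q Q≤q = begin
      eval (p ⊕ negate p′) (ℕ→ℚ q)                     ≡⟨ eval-⊕ p (negate p′) (ℕ→ℚ q) ⟩
      eval p (ℕ→ℚ q) + eval (negate p′) (ℕ→ℚ q)       ≡⟨ cong₂ _+_ (agree q Q≤q) (eval-negate p′ (ℕ→ℚ q)) ⟩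
      eval p′ (ℕ→ℚ q) - eval p′ (ℕ→ℚ q)               ≡⟨ ℚₚ.+-inverseʳ (eval p′ (ℕ→ℚ q)) ⟩
      0ℚ                                               ∎

  sumℚ-suc : ∀ s f → sumℚ (suc s) f ≡ f 0 + sumℚ s (f ∘ suc)
  sumℚ-suc s f = cong (λ xs → f 0 + foldr _+_ 0ℚ xs)
    (trans (Listₚ.map-applyUpTo suc f s) (sym (Listₚ.map-applyUpTo (λ ℓ → ℓ) (f ∘ suc) s)))

  sumℚ-cong : ∀ s {f g} → (∀ ℓ → ℓ < s → f ℓ ≡ g ℓ) → sumℚ s f ≡ sumℚ s g
  sumℚ-cong zero    _  = refl
  sumℚ-cong (suc s) {f} {g} eq = begin
    sumℚ (suc s) f          ≡⟨ sumℚ-suc s f ⟩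
    f 0 + sumℚ s (f ∘ suc)  ≡⟨ cong₂ _+_ (eq 0 (s≤s z≤n)) (sumℚ-cong s (λ ℓ ℓ<s → eq (suc ℓ) (s≤s ℓ<s))) ⟩
    g 0 + sumℚ s (g ∘ suc)  ≡⟨ sumℚ-suc s g ⟨
    sumℚ (suc s) g          ∎
    where open ≡-Reasoning

  sumℚ-*ʳ : ∀ s f c → sumℚ s (λ ℓ → f ℓ * c) ≡ sumℚ s f * c
  sumℚ-*ʳ zero    f c = sym (ℚₚ.*-zeroˡ c)
  sumℚ-*ʳ (suc s) f c = begin
    sumℚ (suc s) (λ ℓ → f ℓ * c)                ≡⟨ sumℚ-suc s (λ ℓ → f ℓ * c) ⟩
    f 0 * c + sumℚ s (λ ℓ → f (suc ℓ) * c)      ≡⟨ cong (f 0 * c +_) (sumℚ-*ʳ s (f ∘ suc) c) ⟩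
    f 0 * c + sumℚ s (f ∘ suc) * c              ≡⟨ ℚₚ.*-distribʳ-+ c (f 0) _ ⟨
    (f 0 + sumℚ s (f ∘ suc)) * c                ≡⟨ cong (_* c) (sumℚ-suc s f) ⟨
    sumℚ (suc s) f * c                          ∎
    where open ≡-Reasoning

  ℕ→ℚ-∑ : ∀ s F → ℕ→ℚ (∑ s F) ≡ sumℚ s (ℕ→ℚ ∘ F)
  ℕ→ℚ-∑ zero    F = refl
  ℕ→ℚ-∑ (suc s) F = trans (ℕ→ℚ-+ (F 0) _) (trans (cong (ℕ→ℚ (F 0) +_) (ℕ→ℚ-∑ s (F ∘ suc))) (sym (sumℚ-suc s (ℕ→ℚ ∘ F))))

  ∑ₚ : ℕ → (ℕ → Poly) → Poly
  ∑ₚ zero    P = []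
  ∑ₚ (suc s) P = P 0 ⊕ ∑ₚ s (P ∘ suc)

  eval-∑ₚ : ∀ s P x → eval (∑ₚ s P) x ≡ sumℚ s (λ ℓ → eval (P ℓ) x)
  eval-∑ₚ zero    P x = refl
  eval-∑ₚ (suc s) P x = trans (eval-⊕ (P 0) _ x)
    (trans (cong (eval (P 0) x +_) (eval-∑ₚ s (P ∘ suc) x)) (sym (sumℚ-suc s (λ ℓ → eval (P ℓ) x))))

module IncreasingLists where

  open import Data.Nat using (ℕ; zero; suc; _∸_; _<_; _≤_; z≤n; s≤s)
  import Data.Nat.Properties as ℕₚ
  open import Data.List using (List; []; _∷_; _++_; [_]; map; take; drop; length)
  import Data.List.Properties as Listₚ
  open import Data.List.Membership.Propositional using (_∈_)
  open import Data.List.Membership.Propositional.Properties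
  open import Data.List.Relation.Unary.Any using (here; there)
  open import Data.List.Relation.Unary.All using (All; _∷_)
  open import Data.List.Relation.Unary.Linked as Linked using (Linked; []; [-]; _∷_)
  open import Data.Product using (∃; _×_; _,_)
  open import Function using (_∘_)
  open import Relation.Binary.PropositionalEquality hiding ([_])
  open import Relation.Nullary using (contradiction)

  ∈-take : ∀ {x : ℕ} n xs → x ∈ take n xs → x ∈ xs
  ∈-take n xs x∈ = subst (_ ∈_) (Listₚ.take++drop≡id n xs) (∈-++⁺ˡ x∈)

  ∈-drop : ∀ {x : ℕ} n xs → x ∈ drop n xs → x ∈ xs
  ∈-drop n xs x∈ = subst (_ ∈_) (Listₚ.take++drop≡id n xs) (∈-++⁺ʳ (take n xs) x∈)

  head< : ∀ {x xs i} → Linked _<_ (x ∷ xs) → i ∈ xs → x < i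
  head< (x<y ∷ _)    (here refl) = x<y
  head< (x<y ∷ y∷xs) (there i∈) = ℕₚ.<-trans x<y (head< y∷xs i∈)

  increasing-≡ : ∀ {xs ys} → Linked _<_ xs → Linked _<_ ys →
                 (∀ {i} → i ∈ xs → i ∈ ys) → (∀ {i} → i ∈ ys → i ∈ xs) → xs ≡ ys
  increasing-≡ {[]}     {[]}     _   _   _   _   = refl
  increasing-≡ {[]}     {y ∷ ys} _   _   _   ys⊆ with () ← ys⊆ (here refl)
  increasing-≡ {x ∷ xs} {[]}     _   _   xs⊆ _   with () ← xs⊆ (here refl)
  increasing-≡ {x ∷ xs} {y ∷ ys} ↗xs ↗ys xs⊆ ys⊆ =
    cong₂ _∷_ x≡y (increasing-≡ (Linked.tail ↗xs) (Linked.tail ↗ys) (tail-⊆ ↗xs x≡y xs⊆) (tail-⊆ ↗ys (sym x≡y) ys⊆))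
    where
    x≡y : x ≡ y
    x≡y with xs⊆ (here refl) | ys⊆ (here refl)
    ... | here x≡y   | _          = x≡y
    ... | there _    | here y≡x   = sym y≡x
    ... | there x∈ys | there y∈xs = contradiction (head< ↗ys x∈ys) (ℕₚ.<⇒≯ (head< ↗xs y∈xs))

    tail-⊆ : ∀ {a b as bs} → Linked _<_ (a ∷ as) → a ≡ b →
             (∀ {i} → i ∈ a ∷ as → i ∈ b ∷ bs) → ∀ {i} → i ∈ as → i ∈ bs
    tail-⊆ ↗as refl ⊆ i∈ with ⊆ (there i∈)
    ... | here refl = contradiction (head< ↗as i∈) (ℕₚ.<-irrefl refl)
    ... | there i∈′ = i∈′

  -- 0-based lookup, returning 0 outside the list.
  at : List ℕ → ℕ → ℕ
  at []       _       = 0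
  at (x ∷ xs) zero    = x
  at (x ∷ xs) (suc ℓ) = at xs ℓ

  at-∈ : ∀ xs {ℓ} → ℓ < length xs → at xs ℓ ∈ xs
  at-∈ (x ∷ xs) {zero}  _         = here refl
  at-∈ (x ∷ xs) {suc ℓ} (s≤s ℓ<) = there (at-∈ xs ℓ<)

  ∈⇒at : ∀ {v} xs → v ∈ xs → ∃ λ ℓ → ℓ < length xs × at xs ℓ ≡ v
  ∈⇒at (x ∷ xs) (here refl) = 0 , s≤s z≤n , refl
  ∈⇒at (x ∷ xs) (there v∈) with ∈⇒at xs v∈
  ... | ℓ , ℓ< , at≡ = suc ℓ , s≤s ℓ< , at≡

  drop-at : ∀ xs {ℓ} → ℓ < length xs → drop ℓ xs ≡ at xs ℓ ∷ drop (suc ℓ) xs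
  drop-at (x ∷ xs) {zero}  _         = refl
  drop-at (x ∷ xs) {suc ℓ} (s≤s ℓ<) = drop-at xs ℓ<

  take-suc-at : ∀ xs {ℓ} → ℓ < length xs → take (suc ℓ) xs ≡ take ℓ xs ++ [ at xs ℓ ]
  take-suc-at (x ∷ xs) {zero}  _         = refl
  take-suc-at (x ∷ xs) {suc ℓ} (s≤s ℓ<) = cong (x ∷_) (take-suc-at xs ℓ<)

  split-at : ∀ xs {ℓ} → ℓ < length xs → xs ≡ take ℓ xs ++ at xs ℓ ∷ drop (suc ℓ) xs
  split-at xs {ℓ} ℓ< = trans (sym (Listₚ.take++drop≡id ℓ xs)) (cong (take ℓ xs ++_) (drop-at xs ℓ<))

  at-injective : ∀ {xs} → Linked _<_ xs → ∀ {ℓ ℓ′} → ℓ < length xs → ℓ′ < length xs → at xs ℓ ≡ at xs ℓ′ → ℓ ≡ ℓ′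
  at-injective {x ∷ xs} ↗ {zero}  {zero}   _         _          _  = refl
  at-injective {x ∷ xs} ↗ {zero}  {suc ℓ′} _         (s≤s ℓ′<) eq = contradiction eq (ℕₚ.<⇒≢ (head< ↗ (at-∈ xs ℓ′<)))
  at-injective {x ∷ xs} ↗ {suc ℓ} {zero}   (s≤s ℓ<)  _          eq = contradiction (sym eq) (ℕₚ.<⇒≢ (head< ↗ (at-∈ xs ℓ<)))
  at-injective {x ∷ xs} ↗ {suc ℓ} {suc ℓ′} (s≤s ℓ<)  (s≤s ℓ′<) eq = cong suc (at-injective (Linked.tail ↗) ℓ< ℓ′< eq)

  take<drop : ∀ {xs} → Linked _<_ xs → ∀ {m n a b} → m ≤ n → a ∈ take m xs → b ∈ drop n xs → a < b
  take<drop {x ∷ xs} ↗ {suc m} {suc n} (s≤s m≤n) (here refl) b∈ = head< ↗ (∈-drop n xs b∈)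
  take<drop {x ∷ xs} ↗ {suc m} {suc n} (s≤s m≤n) (there a∈) b∈ = take<drop (Linked.tail ↗) m≤n a∈ b∈

  Linked-++ : ∀ {xs ys} → Linked _<_ xs → Linked _<_ ys → (∀ {a b} → a ∈ xs → b ∈ ys → a < b) → Linked _<_ (xs ++ ys)
  Linked-++ {[]}              _          ↗ys _   = ↗ys
  Linked-++ {x ∷ []} {[]}     _          _   _   = [-]
  Linked-++ {x ∷ []} {y ∷ ys} _          ↗ys sep = sep (here refl) (here refl) ∷ ↗ys
  Linked-++ {x ∷ x′ ∷ xs}     (x< ∷ ↗xs) ↗ys sep = x< ∷ Linked-++ ↗xs ↗ys (sep ∘ there)

  Linked-take : ∀ n {xs} → Linked _<_ xs → Linked _<_ (take n xs)
  Linked-take zero          _          = []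
  Linked-take (suc n)       []         = []
  Linked-take (suc zero)    [-]        = [-]
  Linked-take (suc zero)    (_ ∷ _)    = [-]
  Linked-take (suc (suc n)) [-]        = [-]
  Linked-take (suc (suc n)) (x< ∷ ↗xs) = x< ∷ Linked-take (suc n) ↗xs

  Linked-drop : ∀ n {xs} → Linked _<_ xs → Linked _<_ (drop n xs)
  Linked-drop zero    ↗ = ↗
  Linked-drop (suc n) {[]}    _ = []
  Linked-drop (suc n) {x ∷ _} ↗ = Linked-drop n (Linked.tail ↗)

  Linked-map-pred : ∀ {xs} → All (1 ≤_) xs → Linked _<_ xs → Linked _<_ (map (_∸ 1) xs)
  Linked-map-pred _                    []           = []
  Linked-map-pred _                    [-]          = [-]
  Linked-map-pred (s≤s _ ∷ x≥1 ∷ xs≥1) (s≤s x< ∷ ↗) = x< ∷ Linked-map-pred (x≥1 ∷ xs≥1) ↗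


module Permutations where

  open import Data.Nat using (ℕ; zero; suc; _<_; _≤_; z≤n; s≤s)
  import Data.Nat.Properties as ℕₚ
  open import Data.List using (List; []; _∷_; _++_; [_]; map; upTo; take; drop; length)
  import Data.List.Properties as Listₚ
  open import Data.List.Membership.Propositional using (_∈_; _∉_)
  open import Data.List.Membership.Propositional.Properties
  open import Data.List.Relation.Unary.Any using (here; there)
  open import Data.List.Relation.Unary.All using (All; []; _∷_)
  open import Data.List.Relation.Unary.AllPairs using ([]; _∷_)
  open import Data.List.Relation.Unary.Unique.Propositional using (Unique)
  import Data.List.Relation.Unary.Unique.Propositional.Properties as Uniqueₚ
  open import Data.List.Relation.Binary.Permutation.Propositional using (_↭_; ↭-sym; ↭-trans; ↭-refl; ↭-reflexive; prep; module PermutationReasoning)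
  import Data.List.Relation.Binary.Permutation.Propositional.Properties as ↭ₚ
  open import Data.Product using (∃; _×_; _,_; proj₂)
  open import Data.Sum using (inj₁; inj₂)
  open import Function using (_∘_)
  open import Relation.Binary.PropositionalEquality hiding ([_])
  open import Relation.Nullary using (contradiction)
  open import Defs
  open IncreasingLists using (∈-take)

  take-length-++ : (xs ys : List ℕ) → take (length xs) (xs ++ ys) ≡ xs
  take-length-++ []       ys = refl
  take-length-++ (x ∷ xs) ys = cong (x ∷_) (take-length-++ xs ys)

  drop-length-++ : (xs ys : List ℕ) → drop (length xs) (xs ++ ys) ≡ ys
  drop-length-++ []       ys = refl
  drop-length-++ (x ∷ xs) ys = drop-length-++ xs ys

  oneTo : ℕ → List ℕ
  oneTo q = map suc (upTo q)

  oneTo-suc : ∀ q → oneTo (suc q) ≡ oneTo q ++ [ suc q ]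
  oneTo-suc q = trans (cong (map suc) (sym (Listₚ.upTo-∷ʳ q))) (Listₚ.map-++ suc (upTo q) [ q ])

  suc∈oneTo-suc : ∀ q → suc q ∈ oneTo (suc q)
  suc∈oneTo-suc q = subst (suc q ∈_) (sym (oneTo-suc q)) (∈-++⁺ʳ (oneTo q) (here refl))

  IsPerm-length : ∀ {q π} → IsPerm q π → length π ≡ q
  IsPerm-length {q} π↭ = trans (↭ₚ.↭-length π↭) (trans (Listₚ.length-map suc (upTo q)) (Listₚ.length-upTo q))

  IsPerm-∈ : ∀ {q π x} → IsPerm q π → x ∈ π → 1 ≤ x × x ≤ q
  IsPerm-∈ π↭ x∈ with ∈-map⁻ suc (↭ₚ.∈-resp-↭ π↭ x∈)
  ... | i , i∈ , refl = s≤s z≤n , ∈-upTo⁻ i∈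

  insertAt : ℕ → ℕ → List ℕ → List ℕ
  insertAt g M σ = take g σ ++ M ∷ drop g σ

  insertAt-↭ : ∀ g M σ → insertAt g M σ ↭ M ∷ σ
  insertAt-↭ g M σ = ↭-trans (↭ₚ.shift M (take g σ) (drop g σ)) (prep M (↭-reflexive (Listₚ.take++drop≡id g σ)))

  concatUpTo : {A : Set} → ℕ → (ℕ → List A) → List A
  concatUpTo zero    f = []
  concatUpTo (suc n) f = f 0 ++ concatUpTo n (f ∘ suc)

  ∈-concatUpTo⁻ : {A : Set} {x : A} → ∀ n f → x ∈ concatUpTo n f → ∃ λ g → g < n × x ∈ f g
  ∈-concatUpTo⁻ (suc n) f x∈ with ∈-++⁻ (f 0) x∈
  ... | inj₁ x∈f0 = 0 , s≤s z≤n , x∈f0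
  ... | inj₂ x∈fs with ∈-concatUpTo⁻ n (f ∘ suc) x∈fs
  ...   | g , g<n , x∈fg = suc g , s≤s g<n , x∈fg

  ∈-concatUpTo⁺ : {A : Set} {x : A} → ∀ n f g → g < n → x ∈ f g → x ∈ concatUpTo n f
  ∈-concatUpTo⁺ (suc n) f zero    _         x∈ = ∈-++⁺ˡ x∈
  ∈-concatUpTo⁺ (suc n) f (suc g) (s≤s g<n) x∈ = ∈-++⁺ʳ (f 0) (∈-concatUpTo⁺ n (f ∘ suc) g g<n x∈)

  concatUpTo-unique : {A : Set} → ∀ n (f : ℕ → List A) → (∀ g → g < n → Unique (f g)) →
                      (∀ {x} g g′ → g < n → g′ < n → x ∈ f g → x ∈ f g′ → g ≡ g′) → Unique (concatUpTo n f)
  concatUpTo-unique zero    f _      _        = []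
  concatUpTo-unique (suc n) f unique disjoint = Uniqueₚ.++⁺ (unique 0 (s≤s z≤n))
    (concatUpTo-unique n (f ∘ suc) (λ g g<n → unique (suc g) (s≤s g<n))
       (λ g g′ g<n g′<n x∈ x∈′ → ℕₚ.suc-injective (disjoint (suc g) (suc g′) (s≤s g<n) (s≤s g′<n) x∈ x∈′)))
    λ (x∈f0 , x∈fs) → let g , g<n , x∈fg = ∈-concatUpTo⁻ n (f ∘ suc) x∈fs
                       in 0≢1+n (disjoint 0 (suc g) (s≤s z≤n) (s≤s g<n) x∈f0 x∈fg)
    where
    0≢1+n : ∀ {m} → 0 ≢ suc m
    0≢1+n ()

  permutations : ℕ → List (List ℕ)
  permutations zero    = [] ∷ []
  permutations (suc q) = concatUpTo (suc q) (λ g → map (insertAt g (suc q)) (permutations q))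

  permutations-sound : ∀ q {π} → π ∈ permutations q → IsPerm q π
  permutations-sound zero    (here refl) = ↭-refl
  permutations-sound (suc q) π∈ with ∈-concatUpTo⁻ (suc q) _ π∈
  ... | g , _ , π∈g with ∈-map⁻ (insertAt g (suc q)) π∈g
  ...   | σ , σ∈ , refl = begin
    insertAt g (suc q) σ   ↭⟨ insertAt-↭ g (suc q) σ ⟩
    suc q ∷ σ              ↭⟨ prep (suc q) (permutations-sound q σ∈) ⟩
    suc q ∷ oneTo q        ↭⟨ ↭ₚ.++-comm [ suc q ] (oneTo q) ⟩
    oneTo q ++ [ suc q ]   ≡⟨ oneTo-suc q ⟨
    oneTo (suc q)          ∎
    where open PermutationReasoning

  permutations-complete : ∀ q {π} → IsPerm q π → π ∈ permutations q
  permutations-complete zero    π↭ rewrite ↭ₚ.↭-empty-inv π↭ = here refl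
  permutations-complete (suc q) π↭ with ∈-∃++ (↭ₚ.∈-resp-↭ (↭-sym π↭) (suc∈oneTo-suc q))
  ... | xs , ys , refl =
    ∈-concatUpTo⁺ (suc q) (λ g → map (insertAt g (suc q)) (permutations q)) (length xs) gap<
      (subst (_∈ map (insertAt (length xs) (suc q)) (permutations q)) insert-eq
        (∈-map⁺ _ (permutations-complete q σ↭)))
    where
    σ↭ : xs ++ ys ↭ oneTo q
    σ↭ = subst (xs ++ ys ↭_) (Listₚ.++-identityʳ (oneTo q))
           (↭ₚ.drop-mid xs (oneTo q) (subst (xs ++ [ suc q ] ++ ys ↭_) (oneTo-suc q) π↭))
    gap< : length xs < suc q
    gap< = s≤s (subst (length xs ≤_) (trans (sym (Listₚ.length-++ xs)) (IsPerm-length σ↭))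
                  (ℕₚ.m≤m+n (length xs) (length ys)))
    insert-eq : insertAt (length xs) (suc q) (xs ++ ys) ≡ xs ++ [ suc q ] ++ ys
    insert-eq = cong₂ (λ as bs → as ++ suc q ∷ bs) (take-length-++ xs ys) (drop-length-++ xs ys)

  Unique-map⁺-∈ : {xs : List (List ℕ)} (f : List ℕ → List ℕ) →
                  (∀ {x y} → x ∈ xs → y ∈ xs → f x ≡ f y → x ≡ y) → Unique xs → Unique (map f xs)
  Unique-map⁺-∈ {[]}     f injective []          = []
  Unique-map⁺-∈ {x ∷ xs} f injective (x∉ ∷ uniq) =
    All-map (λ y∈ → injective (here refl) (there y∈)) x∉ ∷ Unique-map⁺-∈ f (λ a b → injective (there a) (there b)) uniq
    where
    All-map : ∀ {ys} → (∀ {y} → y ∈ ys → f x ≡ f y → x ≡ y) → All (x ≢_) ys → All (f x ≢_) (map f ys)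
    All-map inj []           = []
    All-map inj (x≢y ∷ x≢ys) = (x≢y ∘ inj (here refl)) ∷ All-map (inj ∘ there) x≢ys

  insertAt-cancel : ∀ {M} g g′ σ σ′ → M ∉ σ → M ∉ σ′ → insertAt g M σ ≡ insertAt g′ M σ′ →
                    take g σ ≡ take g′ σ′ × drop g σ ≡ drop g′ σ′
  insertAt-cancel g g′ σ σ′ M∉σ M∉σ′ = split (take g σ) (take g′ σ′) (M∉σ ∘ ∈-take g σ) (M∉σ′ ∘ ∈-take g′ σ′)
    where
    split : ∀ {M ys ys′} xs xs′ → M ∉ xs → M ∉ xs′ → xs ++ M ∷ ys ≡ xs′ ++ M ∷ ys′ → xs ≡ xs′ × ys ≡ ys′
    split []       []        _    _     refl = refl , refl
    split []       (x′ ∷ _)  _    M∉xs′ refl = contradiction (here refl) M∉xs′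
    split (x ∷ _)  []        M∉xs _     refl = contradiction (here refl) M∉xs
    split (x ∷ xs) (x′ ∷ xs′) M∉xs M∉xs′ eq with Listₚ.∷-injective eq
    ... | refl , eq′ with split xs xs′ (M∉xs ∘ there) (M∉xs′ ∘ there) eq′
    ...   | refl , refl = refl , refl

  permutations-unique : ∀ q → Unique (permutations q)
  permutations-unique zero    = [] ∷ []
  permutations-unique (suc q) = concatUpTo-unique (suc q) _
    (λ g _ → Unique-map⁺-∈ (insertAt g (suc q)) (same-gap g) (permutations-unique q))
    different-gaps
    where
    q+1∉ : ∀ {σ} → σ ∈ permutations q → suc q ∉ σ
    q+1∉ σ∈ q+1∈σ = ℕₚ.<-irrefl refl (proj₂ (IsPerm-∈ (permutations-sound q σ∈) q+1∈σ))

    same-gap : ∀ g {σ σ′} → σ ∈ permutations q → σ′ ∈ permutations q →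
               insertAt g (suc q) σ ≡ insertAt g (suc q) σ′ → σ ≡ σ′
    same-gap g {σ} {σ′} σ∈ σ′∈ eq =
      let take≡ , drop≡ = insertAt-cancel g g σ σ′ (q+1∉ σ∈) (q+1∉ σ′∈) eq
      in trans (sym (Listₚ.take++drop≡id g σ)) (trans (cong₂ _++_ take≡ drop≡) (Listₚ.take++drop≡id g σ′))

    different-gaps : ∀ {π} g g′ → g < suc q → g′ < suc q →
                     π ∈ map (insertAt g (suc q)) (permutations q) →
                     π ∈ map (insertAt g′ (suc q)) (permutations q) → g ≡ g′
    different-gaps g g′ (s≤s g≤q) (s≤s g′≤q) π∈ π∈′
      with ∈-map⁻ (insertAt g (suc q)) π∈ | ∈-map⁻ (insertAt g′ (suc q)) π∈′
    ... | σ , σ∈ , π≡ | σ′ , σ′∈ , π≡′ =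
      let take≡ , _ = insertAt-cancel g g′ σ σ′ (q+1∉ σ∈) (q+1∉ σ′∈) (trans (sym π≡) π≡′)
      in trans (sym (take-length σ∈ g≤q)) (trans (cong length take≡) (take-length σ′∈ g′≤q))
      where
      take-length : ∀ {σ g} → σ ∈ permutations q → g ≤ q → length (take g σ) ≡ g
      take-length {σ} {g} σ∈ g≤q = trans (Listₚ.length-take g σ)
        (ℕₚ.m≤n⇒m⊓n≡m (subst (g ≤_) (sym (IsPerm-length (permutations-sound q σ∈))) g≤q))


module Peaks where

  open import Data.Nat using (ℕ; zero; suc; _+_; _∸_; _<_; _≤_; z≤n; s≤s; _≤?_; _<?_)
  import Data.Nat.Properties as ℕₚ
  open import Data.List using (List; []; _∷_; _++_; map; upTo; length; filter)
  open import Data.List.Membership.Propositional using (_∈_; _∉_)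
  open import Data.List.Membership.Propositional.Properties
  open import Data.List.Relation.Unary.Any using (here; there)
  open import Data.List.Relation.Unary.All as All using (All; []; _∷_)
  open import Data.List.Relation.Unary.Linked as Linked using (Linked; _∷_)
  import Data.List.Relation.Unary.Linked.Properties as Linkedₚ
  open import Data.Product using (∃; _×_; _,_; proj₁; proj₂)
  open import Data.Sum using (_⊎_; inj₁; inj₂)
  open import Function using (_∘_)
  open import Relation.Binary.PropositionalEquality
  open import Relation.Nullary using (¬_; Dec; contradiction)
  open import Relation.Nullary.Decidable using (_×-dec_)
  open import Defs
  open IncreasingLists using (head<; increasing-≡)
  open Permutations using (insertAt)

  isPeak? : ∀ π i → Dec (IsPeak π i)
  isPeak? π i = (2 ≤? i) ×-dec (suc i ≤? length π) ×-dec (nth π (i ∸ 1) <? nth π i) ×-dec (nth π (suc i) <? nth π i)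

  peaks : List ℕ → List ℕ
  peaks π = filter (isPeak? π) (upTo (length π))

  ∈-peaks⁻ : ∀ {π i} → i ∈ peaks π → IsPeak π i
  ∈-peaks⁻ {π} i∈ = proj₂ (∈-filter⁻ (isPeak? π) {xs = upTo (length π)} i∈)

  ∈-peaks⁺ : ∀ {π i} → IsPeak π i → i ∈ peaks π
  ∈-peaks⁺ {π} peak@(_ , i<len , _) = ∈-filter⁺ (isPeak? π) (∈-upTo⁺ i<len) peak

  peaks-increasing : ∀ π → Linked _<_ (peaks π)
  peaks-increasing π = Linkedₚ.filter⁺ (isPeak? π) ℕₚ.<-trans (Linkedₚ.applyUpTo⁺₂ (λ i → i) (length π) ℕₚ.n<1+n)

  PeakSetIs⇒peaks≡ : ∀ {π T} → Linked _<_ T → PeakSetIs π T → peaks π ≡ T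
  PeakSetIs⇒peaks≡ {π} ↗T peakSet = increasing-≡ (peaks-increasing π) ↗T
    (λ {i} i∈ → proj₂ (peakSet i) (∈-peaks⁻ {π} i∈)) (λ {i} i∈ → ∈-peaks⁺ {π} (proj₁ (peakSet i) i∈))

  peaks≡⇒PeakSetIs : ∀ {π T} → peaks π ≡ T → PeakSetIs π T
  peaks≡⇒PeakSetIs {π} refl i = ∈-peaks⁻ {π} , ∈-peaks⁺ {π}

  peak-≥2 : ∀ {σ i} → IsPeak σ i → 2 ≤ i
  peak-≥2 (2≤i , _) = 2≤i

  peak-<length : ∀ {σ i} → IsPeak σ i → suc i ≤ length σ
  peak-<length (_ , i<len , _) = i<len

  ¬consecutive-peaks : ∀ {σ i} → IsPeak σ i → ¬ IsPeak σ (suc i)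
  ¬consecutive-peaks (_ , _ , _ , next<) (_ , _ , prev< , _) = ℕₚ.<-asym next< prev<

  -- Where an index lies relative to an entry inserted at gap g, which lands at position g + 1.
  data Position (g : ℕ) : ℕ → Set where
    left   : ∀ {i} → i < g → Position g i
    before : Position g g
    top    : Position g (suc g)
    after  : Position g (suc (suc g))
    right  : ∀ {i} → suc (suc g) ≤ i → Position g (suc i)

  position : ∀ g i → Position g i
  position zero    zero                = before
  position zero    (suc zero)          = top
  position zero    (suc (suc zero))    = after
  position zero    (suc (suc (suc i))) = right (s≤s (s≤s z≤n))
  position (suc g) zero                = left (s≤s z≤n)
  position (suc g) (suc i) with position g i
  ... | left i<g    = left (s≤s i<g)
  ... | before      = before
  ... | top         = top
  ... | after       = after
  ... | right g+2≤i = right (s≤s g+2≤i)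

  nth-0 : ∀ π → nth π 0 ≡ 0
  nth-0 []      = refl
  nth-0 (_ ∷ _) = refl

  nth-insertAt-≤ : ∀ {g} M σ j → g ≤ length σ → j ≤ g → nth (insertAt g M σ) j ≡ nth σ j
  nth-insertAt-≤ {g}     M σ       zero          _         _         = trans (nth-0 (insertAt g M σ)) (sym (nth-0 σ))
  nth-insertAt-≤ {suc g} M (x ∷ σ) (suc zero)    _         _         = refl
  nth-insertAt-≤ {suc g} M (x ∷ σ) (suc (suc j)) (s≤s g≤) (s≤s j≤g) = nth-insertAt-≤ M σ (suc j) g≤ j≤g

  nth-insertAt-≡ : ∀ {g} M σ → g ≤ length σ → nth (insertAt g M σ) (suc g) ≡ M
  nth-insertAt-≡ {zero}  M σ       _        = refl
  nth-insertAt-≡ {suc g} M (x ∷ σ) (s≤s g≤) = nth-insertAt-≡ M σ g≤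

  nth-insertAt-> : ∀ {g} M σ j → g ≤ length σ → suc g ≤ j → nth (insertAt g M σ) (suc j) ≡ nth σ j
  nth-insertAt-> {zero}  M σ       (suc j)       _        _           = refl
  nth-insertAt-> {suc g} M (x ∷ σ) (suc (suc j)) (s≤s g≤) (s≤s g<j) = nth-insertAt-> M σ (suc j) g≤ g<j

  length-insertAt : ∀ {g} M σ → g ≤ length σ → length (insertAt g M σ) ≡ suc (length σ)
  length-insertAt {zero}  M σ       _        = refl
  length-insertAt {suc g} M (x ∷ σ) (s≤s g≤) = cong suc (length-insertAt M σ g≤)

  -- 0 < M covers the value 0 that nth returns outside σ.
  nth-< : ∀ {M} σ → All (_< M) σ → 0 < M → ∀ j → nth σ j < M
  nth-< []      _           0<M j             = 0<M
  nth-< (x ∷ σ) _           0<M zero          = 0<M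
  nth-< (x ∷ σ) (x<M ∷ _)   0<M (suc zero)    = x<M
  nth-< (x ∷ σ) (_ ∷ σ<M)   0<M (suc (suc j)) = nth-< σ σ<M 0<M (suc j)

  IsPeak-transfer : ∀ π σ i i′ → (2 ≤ i → 2 ≤ i′) → (suc i ≤ length π → suc i′ ≤ length σ) →
                    nth π (i ∸ 1) ≡ nth σ (i′ ∸ 1) → nth π i ≡ nth σ i′ → nth π (suc i) ≡ nth σ (suc i′) →
                    IsPeak π i → IsPeak σ i′
  IsPeak-transfer π σ i i′ ≥2 <len prev mid next (a , b , c , d) = ≥2 a , <len b , subst₂ _<_ prev mid c , subst₂ _<_ next mid d

  module InsertMax {g M : ℕ} (σ : List ℕ) (g≤ : g ≤ length σ) (σ<M : All (_< M) σ) (0<M : 0 < M) where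

    π : List ℕ
    π = insertAt g M σ

    length-π : length π ≡ suc (length σ)
    length-π = length-insertAt M σ g≤

    nth-left : ∀ j → j ≤ g → nth π j ≡ nth σ j
    nth-left j = nth-insertAt-≤ M σ j g≤

    nth-right : ∀ j → suc g ≤ j → nth π (suc j) ≡ nth σ j
    nth-right j = nth-insertAt-> M σ j g≤

    nth-top : nth π (suc g) ≡ M
    nth-top = nth-insertAt-≡ M σ g≤

    below-M : ∀ j → nth σ j < M
    below-M = nth-< σ σ<M 0<M

    peak-left⁻ : ∀ {i} → i < g → IsPeak π i → IsPeak σ i
    peak-left⁻ {i} i<g = IsPeak-transfer π σ i i (λ 2≤i → 2≤i) (λ _ → ℕₚ.≤-trans i<g g≤)
      (nth-left (i ∸ 1) (ℕₚ.≤-trans (ℕₚ.m∸n≤m i 1) (ℕₚ.<⇒≤ i<g))) (nth-left i (ℕₚ.<⇒≤ i<g)) (nth-left (suc i) i<g)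

    peak-left⁺ : ∀ {i} → i < g → IsPeak σ i → IsPeak π i
    peak-left⁺ {i} i<g = IsPeak-transfer σ π i i
      (λ 2≤i → 2≤i) (λ i<len → subst (suc i ≤_) (sym length-π) (ℕₚ.m≤n⇒m≤1+n i<len))
      (sym (nth-left (i ∸ 1) (ℕₚ.≤-trans (ℕₚ.m∸n≤m i 1) (ℕₚ.<⇒≤ i<g)))) (sym (nth-left i (ℕₚ.<⇒≤ i<g))) (sym (nth-left (suc i) i<g))

    ¬peak-before : ¬ IsPeak π g
    ¬peak-before (_ , _ , _ , M<σg) = ℕₚ.<-asym M<σg (subst₂ _<_ (sym (nth-left g ℕₚ.≤-refl)) (sym nth-top) (below-M g))

    nth-after : nth π (suc (suc g)) ≡ nth σ (suc g)
    nth-after = nth-right (suc g) ℕₚ.≤-refl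

    peak-at : 1 ≤ g → g < length σ → IsPeak π (suc g)
    peak-at 1≤g g<len = s≤s 1≤g , subst (suc (suc g) ≤_) (sym length-π) (s≤s g<len)
      , subst₂ _<_ (sym (nth-left g ℕₚ.≤-refl)) (sym nth-top) (below-M g)
      , subst₂ _<_ (sym nth-after) (sym nth-top) (below-M (suc g))

    ¬peak-at-back : g ≡ length σ → ¬ IsPeak π (suc g)
    ¬peak-at-back refl (_ , g+2≤len , _) = ℕₚ.<-irrefl refl (subst (suc (suc g) ≤_) length-π g+2≤len)

    ¬peak-after : ¬ IsPeak π (suc (suc g))
    ¬peak-after (_ , _ , M<σg+1 , _) = ℕₚ.<-asym M<σg+1 (subst₂ _<_ (sym nth-after) (sym nth-top) (below-M (suc g)))

    peak-right⁻ : ∀ {i} → suc (suc g) ≤ i → IsPeak π (suc i) → IsPeak σ i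
    peak-right⁻ {suc i} (s≤s g<i) = IsPeak-transfer π σ (suc (suc i)) (suc i)
      (λ _ → s≤s (ℕₚ.≤-trans (s≤s z≤n) g<i)) (λ i<len → ℕₚ.≤-pred (subst (_ ≤_) length-π i<len))
      (nth-right i g<i) (nth-right (suc i) (ℕₚ.m≤n⇒m≤1+n g<i)) (nth-right (suc (suc i)) (ℕₚ.m≤n⇒m≤1+n (ℕₚ.m≤n⇒m≤1+n g<i)))

    peak-right⁺ : ∀ {i} → suc (suc g) ≤ i → IsPeak σ i → IsPeak π (suc i)
    peak-right⁺ {suc i} (s≤s g<i) = IsPeak-transfer σ π (suc i) (suc (suc i))
      (λ _ → s≤s (s≤s z≤n)) (λ i<len → subst (_ ≤_) (sym length-π) (s≤s i<len))
      (sym (nth-right i g<i)) (sym (nth-right (suc i) (ℕₚ.m≤n⇒m≤1+n g<i))) (sym (nth-right (suc (suc i)) (ℕₚ.m≤n⇒m≤1+n (ℕₚ.m≤n⇒m≤1+n g<i))))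

  ∈-map-pred⁻ : ∀ {j S} → All (1 ≤_) S → j ∈ map (_∸ 1) S → suc j ∈ S
  ∈-map-pred⁻ S≥1 j∈ with ∈-map⁻ (_∸ 1) j∈
  ... | s , s∈ , refl with All.lookup S≥1 s∈
  ...   | s≤s _ = s∈

  module InsertFront {M : ℕ} (σ : List ℕ) (σ<M : All (_< M) σ) (0<M : 0 < M) where
    open InsertMax {0} σ z≤n σ<M 0<M public

    ¬peak-0 : ∀ {τ} → ¬ IsPeak τ 0
    ¬peak-0 (() , _)

    peak-front⁻ : ∀ j → IsPeak π (suc j) → IsPeak σ j
    peak-front⁻ zero          (s≤s () , _)
    peak-front⁻ (suc zero)    peak = contradiction peak ¬peak-after
    peak-front⁻ (suc (suc j)) peak = peak-right⁻ (s≤s (s≤s z≤n)) peak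

    peak-front⁺ : ∀ j → IsPeak σ j → IsPeak π (suc j)
    peak-front⁺ (suc (suc j)) peak = peak-right⁺ (s≤s (s≤s z≤n)) peak
    peak-front⁺ zero          (() , _)
    peak-front⁺ (suc zero)    (s≤s () , _)

    PeakSetIs⁻ : ∀ S → PeakSetIs π S → PeakSetIs σ (map (_∸ 1) S)
    PeakSetIs⁻ S peakSet j = to , from
      where
      to : j ∈ map (_∸ 1) S → IsPeak σ j
      to j∈ with ∈-map⁻ (_∸ 1) j∈
      ... | zero  , 0∈S , refl = contradiction (proj₁ (peakSet 0) 0∈S) (¬peak-0 {π})
      ... | suc s , s∈S , refl = peak-front⁻ s (proj₁ (peakSet (suc s)) s∈S)
      from : IsPeak σ j → j ∈ map (_∸ 1) S
      from peak = ∈-map⁺ (_∸ 1) (proj₂ (peakSet (suc j)) (peak-front⁺ j peak))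

    PeakSetIs⁺ : ∀ S → All (1 ≤_) S → PeakSetIs σ (map (_∸ 1) S) → PeakSetIs π S
    PeakSetIs⁺ S S≥1 peakSet zero    = (λ 0∈S → contradiction (All.lookup S≥1 0∈S) λ ()) , (λ peak → contradiction peak (¬peak-0 {π}))
    PeakSetIs⁺ S S≥1 peakSet (suc j) = (λ s∈S → peak-front⁺ j (proj₁ (peakSet j) (∈-map⁺ (_∸ 1) s∈S)))
                                     , (λ peak → ∈-map-pred⁻ S≥1 (proj₂ (peakSet j) (peak-front⁻ j peak)))

  module InsertBack {M : ℕ} (σ : List ℕ) (σ<M : All (_< M) σ) (0<M : 0 < M) where
    open InsertMax {length σ} σ ℕₚ.≤-refl σ<M 0<M public

    ¬peak-beyond : ∀ {i} → suc (suc (length σ)) ≤ i → ¬ IsPeak π i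
    ¬peak-beyond g+2≤i peak = ℕₚ.<-irrefl refl
      (ℕₚ.≤-trans (s≤s g+2≤i) (ℕₚ.≤-trans (subst (_ ≤_) length-π (peak-<length {π} peak)) (ℕₚ.n≤1+n _)))

    peak-back⁻ : ∀ i → IsPeak π i → IsPeak σ i
    peak-back⁻ i peak with position (length σ) i
    ... | left i<g    = peak-left⁻ i<g peak
    ... | before      = contradiction peak ¬peak-before
    ... | top         = contradiction peak (¬peak-at-back refl)
    ... | after       = contradiction peak (¬peak-beyond ℕₚ.≤-refl)
    ... | right g+2≤j = contradiction peak (¬peak-beyond (ℕₚ.m≤n⇒m≤1+n g+2≤j))

    peak-back⁺ : ∀ i → IsPeak σ i → IsPeak π i
    peak-back⁺ i peak = peak-left⁺ (peak-<length {σ} peak) peak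

    PeakSetIs⁻ : ∀ S → PeakSetIs π S → PeakSetIs σ S
    PeakSetIs⁻ S peakSet i = peak-back⁻ i ∘ proj₁ (peakSet i) , proj₂ (peakSet i) ∘ peak-back⁺ i

    PeakSetIs⁺ : ∀ S → PeakSetIs σ S → PeakSetIs π S
    PeakSetIs⁺ S peakSet i = peak-back⁺ i ∘ proj₁ (peakSet i) , proj₂ (peakSet i) ∘ peak-back⁻ i

  module InsertMiddle {g M : ℕ} (σ : List ℕ) (σ<M : All (_< M) σ) (0<M : 0 < M) (1≤g : 1 ≤ g) (g<len : g < length σ)
                      (A B : List ℕ) (A<g : ∀ {a} → a ∈ A → a < g) (g+3≤B : ∀ {b} → b ∈ B → suc (suc (suc g)) ≤ b) where
    open InsertMax σ (ℕₚ.<⇒≤ g<len) σ<M 0<M public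

    S : List ℕ
    S = A ++ suc g ∷ B

    Middle : List ℕ → Set
    Middle mid = ∀ {j} → j ∈ mid → j ≡ g ⊎ j ≡ suc g

    -- The peak set of σ matching S, where mid ⊆ {g, g + 1} holds the peaks of σ destroyed by the insertion.
    collapse : List ℕ → List ℕ
    collapse mid = A ++ mid ++ map (_∸ 1) B

    B≥1 : All (1 ≤_) B
    B≥1 = All.tabulate (λ b∈ → ℕₚ.≤-trans (s≤s z≤n) (g+3≤B b∈))

    g+2≤B′ : ∀ {j} → j ∈ map (_∸ 1) B → suc (suc g) ≤ j
    g+2≤B′ j∈ = ℕₚ.≤-pred (g+3≤B (∈-map-pred⁻ B≥1 j∈))

    ∈S⁻ : ∀ {i} → i ∈ S → i ∈ A ⊎ i ≡ suc g ⊎ i ∈ B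
    ∈S⁻ i∈ with ∈-++⁻ A i∈
    ... | inj₁ i∈A         = inj₁ i∈A
    ... | inj₂ (here i≡)   = inj₂ (inj₁ i≡)
    ... | inj₂ (there i∈B) = inj₂ (inj₂ i∈B)

    ∈S-left : ∀ {i} → i < g → i ∈ S → i ∈ A
    ∈S-left i<g i∈ with ∈S⁻ i∈
    ... | inj₁ i∈A         = i∈A
    ... | inj₂ (inj₁ refl) = contradiction i<g (ℕₚ.<-asym (ℕₚ.n<1+n g))
    ... | inj₂ (inj₂ i∈B)  = contradiction (ℕₚ.≤-trans (ℕₚ.m≤n+m g 3) (g+3≤B i∈B)) (ℕₚ.<⇒≱ i<g)

    ∈S-right : ∀ {i} → suc (suc (suc g)) ≤ i → i ∈ S → i ∈ B
    ∈S-right g+3≤i i∈ with ∈S⁻ i∈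
    ... | inj₁ i∈A         = contradiction (ℕₚ.≤-trans (ℕₚ.m≤n+m g 3) g+3≤i) (ℕₚ.<⇒≱ (A<g i∈A))
    ... | inj₂ (inj₁ refl) = contradiction g+3≤i (ℕₚ.<⇒≱ (ℕₚ.m≤n⇒m≤1+n ℕₚ.≤-refl))
    ... | inj₂ (inj₂ i∈B)  = i∈B

    ∈collapse⁻ : ∀ {mid j} → j ∈ collapse mid → j ∈ A ⊎ j ∈ mid ⊎ j ∈ map (_∸ 1) B
    ∈collapse⁻ {mid} j∈ with ∈-++⁻ A j∈
    ... | inj₁ j∈A = inj₁ j∈A
    ... | inj₂ j∈′ = inj₂ (∈-++⁻ mid j∈′)

    ∈collapse-left : ∀ {mid j} → Middle mid → j < g → j ∈ collapse mid → j ∈ A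
    ∈collapse-left middle j<g j∈ with ∈collapse⁻ j∈
    ... | inj₁ j∈A         = j∈A
    ... | inj₂ (inj₁ j∈mid) with middle j∈mid
    ...   | inj₁ refl = contradiction j<g (ℕₚ.<-irrefl refl)
    ...   | inj₂ refl = contradiction j<g (ℕₚ.<-asym (ℕₚ.n<1+n g))
    ∈collapse-left middle j<g j∈ | inj₂ (inj₂ j∈B′) =
      contradiction (ℕₚ.≤-trans (ℕₚ.m≤n+m g 2) (g+2≤B′ j∈B′)) (ℕₚ.<⇒≱ j<g)

    ∈collapse-middle : ∀ {mid j} → Middle mid → g ≤ j → j ≤ suc g → j ∈ collapse mid → j ∈ mid
    ∈collapse-middle middle g≤j j≤g+1 j∈ with ∈collapse⁻ j∈
    ... | inj₁ j∈A         = contradiction (A<g j∈A) (ℕₚ.≤⇒≯ g≤j)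
    ... | inj₂ (inj₁ j∈mid) = j∈mid
    ... | inj₂ (inj₂ j∈B′) = contradiction (g+2≤B′ j∈B′) (ℕₚ.<⇒≱ (s≤s j≤g+1))

    ∈collapse-right : ∀ {mid j} → Middle mid → suc (suc g) ≤ j → j ∈ collapse mid → j ∈ map (_∸ 1) B
    ∈collapse-right middle g+2≤j j∈ with ∈collapse⁻ j∈
    ... | inj₁ j∈A         = contradiction (ℕₚ.≤-trans (ℕₚ.m≤n+m g 2) g+2≤j) (ℕₚ.<⇒≱ (A<g j∈A))
    ... | inj₂ (inj₁ j∈mid) with middle j∈mid
    ...   | inj₁ refl = contradiction g+2≤j (ℕₚ.<⇒≱ (ℕₚ.≤-trans (ℕₚ.n<1+n _) (ℕₚ.n≤1+n _)))
    ...   | inj₂ refl = contradiction g+2≤j (ℕₚ.<⇒≱ (ℕₚ.n<1+n _))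
    ∈collapse-right middle g+2≤j j∈ | inj₂ (inj₂ j∈B′) = j∈B′

    ∈collapse⁺ : ∀ {mid j} → j ∈ A ⊎ j ∈ mid ⊎ j ∈ map (_∸ 1) B → j ∈ collapse mid
    ∈collapse⁺         (inj₁ j∈A)         = ∈-++⁺ˡ j∈A
    ∈collapse⁺ {mid}   (inj₂ (inj₁ j∈mid)) = ∈-++⁺ʳ A (∈-++⁺ˡ j∈mid)
    ∈collapse⁺ {mid}   (inj₂ (inj₂ j∈B′)) = ∈-++⁺ʳ A (∈-++⁺ʳ mid j∈B′)

    B-shape : ∀ {b} → b ∈ B → ∃ λ j → b ≡ suc j × suc (suc g) ≤ j
    B-shape b∈ with g+3≤B b∈
    ... | s≤s g+2≤j = _ , refl , g+2≤j

    PeakSetIs⁺ : ∀ mid → Middle mid → PeakSetIs σ (collapse mid) → PeakSetIs π S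
    PeakSetIs⁺ mid middle peakSet i = to , from
      where
      to : i ∈ S → IsPeak π i
      to i∈ with ∈S⁻ i∈
      ... | inj₁ i∈A         = peak-left⁺ (A<g i∈A) (proj₁ (peakSet i) (∈collapse⁺ (inj₁ i∈A)))
      ... | inj₂ (inj₁ refl) = peak-at 1≤g g<len
      ... | inj₂ (inj₂ i∈B) with B-shape i∈B
      ...   | j , refl , g+2≤j = peak-right⁺ g+2≤j (proj₁ (peakSet j) (∈collapse⁺ (inj₂ (inj₂ (∈-map⁺ (_∸ 1) i∈B)))))
      from : IsPeak π i → i ∈ S
      from peak with position g i
      ... | left i<g    = ∈-++⁺ˡ (∈collapse-left middle i<g (proj₂ (peakSet i) (peak-left⁻ i<g peak)))
      ... | before      = contradiction peak ¬peak-before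
      ... | top         = ∈-++⁺ʳ A (here refl)
      ... | after       = contradiction peak ¬peak-after
      ... | right g+2≤j = ∈-++⁺ʳ A (there (∈-map-pred⁻ B≥1
                            (∈collapse-right middle g+2≤j (proj₂ (peakSet _) (peak-right⁻ g+2≤j peak)))))

    PeakSetIs⁻ : ∀ mid → Middle mid → (IsPeak σ g → g ∈ mid) → (IsPeak σ (suc g) → suc g ∈ mid) →
                 (∀ {j} → j ∈ mid → IsPeak σ j) → PeakSetIs π S → PeakSetIs σ (collapse mid)
    PeakSetIs⁻ mid middle peak-g peak-g+1 mid⇒peak peakSet j = to , from
      where
      to : j ∈ collapse mid → IsPeak σ j
      to j∈ with ∈collapse⁻ j∈
      ... | inj₁ j∈A          = peak-left⁻ (A<g j∈A) (proj₁ (peakSet j) (∈-++⁺ˡ j∈A))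
      ... | inj₂ (inj₁ j∈mid) = mid⇒peak j∈mid
      ... | inj₂ (inj₂ j∈B′)  = peak-right⁻ (g+2≤B′ j∈B′) (proj₁ (peakSet (suc j)) (∈-++⁺ʳ A (there (∈-map-pred⁻ B≥1 j∈B′))))
      from-right : suc (suc g) ≤ j → IsPeak σ j → j ∈ collapse mid
      from-right g+2≤j peak = ∈collapse⁺ (inj₂ (inj₂ (∈-map⁺ (_∸ 1) (∈S-right (s≤s g+2≤j) (proj₂ (peakSet (suc j)) (peak-right⁺ g+2≤j peak))))))
      from : IsPeak σ j → j ∈ collapse mid
      from peak with position g j
      ... | left j<g    = ∈collapse⁺ (inj₁ (∈S-left j<g (proj₂ (peakSet j) (peak-left⁺ j<g peak))))
      ... | before      = ∈collapse⁺ (inj₂ (inj₁ (peak-g peak)))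
      ... | top         = ∈collapse⁺ (inj₂ (inj₁ (peak-g+1 peak)))
      ... | after       = from-right ℕₚ.≤-refl peak
      ... | right g+2≤i = from-right (ℕₚ.m≤n⇒m≤1+n g+2≤i) peak

    collapse-≢ : ∀ {mid mid′ j} → Middle mid′ → g ≤ j → j ≤ suc g → j ∈ mid → j ∉ mid′ → collapse mid ≢ collapse mid′
    collapse-≢ middle′ g≤j j≤g+1 j∈ j∉ eq =
      j∉ (∈collapse-middle middle′ g≤j j≤g+1 (subst (_ ∈_) eq (∈collapse⁺ (inj₂ (inj₁ j∈)))))


module PeakCounts where

  open import Data.Nat using (ℕ; zero; suc; _+_; _∸_; _<_; _≤_; z≤n; s≤s)
  import Data.Nat.Properties as ℕₚ
  open import Data.Nat.Tactic.RingSolver using (solve-∀)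
  open import Data.List using (List; []; _∷_; _++_; [_]; map; take; drop; length; filter)
  import Data.List.Properties as Listₚ
  open import Data.List.Membership.Propositional using (_∈_; _∉_)
  open import Data.List.Membership.Propositional.Properties
  open import Data.List.Membership.DecPropositional ℕₚ._≟_ using (_∈?_)
  open import Data.List.Relation.Unary.Any using (here; there)
  open import Data.List.Relation.Unary.All as All using (All; []; _∷_)
  open import Data.List.Relation.Unary.Linked as Linked using (Linked; []; [-]; _∷_)
  import Data.List.Relation.Unary.Unique.Propositional.Properties as Uniqueₚ
  open import Data.Product using (∃; _×_; _,_; proj₁; proj₂)
  open import Data.Sum using (_⊎_; inj₁; inj₂)
  open import Function using (_∘_)
  open import Relation.Binary.PropositionalEquality hiding ([_])
  open import Relation.Nullary using (¬_; Dec; yes; no; contradiction)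
  open import Relation.Unary using (Decidable)
  open import Defs
  open Counting
  open IncreasingLists
  open Permutations
  open Peaks

  length-Sℓ : ∀ S ℓ → length (Sℓ S ℓ) ≡ length S
  length-Sℓ S       zero    = Listₚ.length-map (_∸ 1) S
  length-Sℓ []      (suc ℓ) = refl
  length-Sℓ (x ∷ S) (suc ℓ) = cong suc (length-Sℓ S ℓ)

  length-Ŝℓ : ∀ S {ℓ} → ℓ < length S → suc (length (Ŝℓ S ℓ)) ≡ length S
  length-Ŝℓ (x ∷ S) {zero}  _         = cong suc (Listₚ.length-map (_∸ 1) S)
  length-Ŝℓ (x ∷ S) {suc ℓ} (s≤s ℓ<) = cong suc (length-Ŝℓ S ℓ<)

  record ValidPeakSet (S : List ℕ) : Set where
    field
      increasing       : Linked _<_ S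
      ≥2               : All (2 ≤_) S
      ¬consecutive     : ∀ {x} → x ∈ S → suc x ∉ S

    ≥1 : All (1 ≤_) S
    ≥1 = All.map (ℕₚ.≤-trans (s≤s z≤n)) ≥2

  open ValidPeakSet

  Admissible⇒valid : ∀ {S n} → Linked _<_ S → Admissible S n → ValidPeakSet S × All (_≤ n) S
  Admissible⇒valid {S} ↗ (π , π↭ , peakSet) =
    record { increasing   = ↗
           ; ≥2           = All.tabulate (λ {x} x∈ → peak-≥2 {π} (proj₁ (peakSet x) x∈))
           ; ¬consecutive = λ {x} x∈ x+1∈ → ¬consecutive-peaks {π} (proj₁ (peakSet x) x∈) (proj₁ (peakSet (suc x)) x+1∈) }
    , All.tabulate (λ {x} x∈ → ℕₚ.<⇒≤ (subst (suc x ≤_) (IsPerm-length π↭) (peak-<length {π} (proj₁ (peakSet x) x∈))))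

  module _ {S} (valid : ValidPeakSet S) where

    -- Shifting drop n S down by one keeps it above take m S because no two peaks are adjacent.
    Linked-take++drop-pred : ∀ {m n} → m ≤ n → Linked _<_ (take m S ++ map (_∸ 1) (drop n S))
    Linked-take++drop-pred {m} {n} m≤n = Linked-++ (Linked-take m (increasing valid))
      (Linked-map-pred (All.tabulate (All.lookup (≥1 valid) ∘ ∈-drop n S)) (Linked-drop n (increasing valid)))
      separated
      where
      separated : ∀ {a b} → a ∈ take m S → b ∈ map (_∸ 1) (drop n S) → a < b
      separated a∈ b∈ with ∈-map⁻ (_∸ 1) b∈
      ... | zero  , 0∈ , refl = contradiction (All.lookup (≥2 valid) (∈-drop n S 0∈)) λ ()
      ... | suc b , b+1∈ , refl with take<drop (increasing valid) m≤n a∈ b+1∈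
      ...   | s≤s a≤b with ℕₚ.m≤n⇒m<n∨m≡n a≤b
      ...     | inj₁ a<b  = a<b
      ...     | inj₂ refl = contradiction (∈-drop n S b+1∈) (¬consecutive valid (∈-take m S a∈))

    Sℓ-increasing : ∀ ℓ → Linked _<_ (Sℓ S ℓ)
    Sℓ-increasing ℓ = Linked-take++drop-pred {ℓ} ℕₚ.≤-refl

    Ŝℓ-increasing : ∀ ℓ → Linked _<_ (Ŝℓ S ℓ)
    Ŝℓ-increasing ℓ = Linked-take++drop-pred {ℓ} (ℕₚ.n≤1+n ℓ)

  peaks≡? : ∀ T σ → Dec (peaks σ ≡ T)
  peaks≡? T σ = Listₚ.≡-dec ℕₚ._≟_ (peaks σ) T

  peakCount : List ℕ → ℕ → ℕ
  peakCount T q = count (peaks≡? T) (permutations q)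

  peakCount-HasCount : ∀ {T} q → Linked _<_ T → HasCount T q (peakCount T q)
  peakCount-HasCount {T} q ↗T = filter (peaks≡? T) (permutations q)
    , Uniqueₚ.filter⁺ (peaks≡? T) (permutations-unique q)
    , All.tabulate (λ {π} π∈ → let π∈q , peaks≡ = ∈-filter⁻ (peaks≡? T) {xs = permutations q} π∈
                               in permutations-sound q π∈q , peaks≡⇒PeakSetIs {π} peaks≡)
    , (λ π π↭ peakSet → ∈-filter⁺ (peaks≡? T) (permutations-complete q π↭) (PeakSetIs⇒peaks≡ {π} ↗T peakSet))
    , refl

  peakCount-¬Admissible : ∀ {T} q → ¬ Admissible T q → peakCount T q ≡ 0
  peakCount-¬Admissible {T} q ¬adm =
    count-none (peaks≡? T) (permutations q) (λ σ σ∈ peaks≡ → ¬adm (σ , permutations-sound q σ∈ , peaks≡⇒PeakSetIs {σ} peaks≡))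

  permutation-<-suc : ∀ q {σ} → σ ∈ permutations q → All (_< suc q) σ
  permutation-<-suc q σ∈ = All.tabulate (λ x∈ → s≤s (proj₂ (IsPerm-∈ (permutations-sound q σ∈) x∈)))

  permutation-length : ∀ q {σ} → σ ∈ permutations q → length σ ≡ q
  permutation-length q σ∈ = IsPerm-length (permutations-sound q σ∈)

  Admissible-suc : ∀ {T q} → Admissible T q → Admissible T (suc q)
  Admissible-suc {T} {q} (π , π↭ , peakSet) = insertAt (length π) (suc q) π
    , permutations-sound (suc q) (∈-concatUpTo⁺ (suc q) (λ g → map (insertAt g (suc q)) (permutations q)) (length π)
        (s≤s (ℕₚ.≤-reflexive (IsPerm-length π↭))) (∈-map⁺ (insertAt (length π) (suc q)) π∈))
    , InsertBack.PeakSetIs⁺ π (permutation-<-suc q π∈) (s≤s z≤n) T peakSet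
    where π∈ = permutations-complete q π↭

  Admissible-mono : ∀ {T q q′} → q ≤ q′ → Admissible T q → Admissible T q′
  Admissible-mono {q′ = zero}   z≤n adm = adm
  Admissible-mono {q′ = suc q′} q≤q′ adm with ℕₚ.m≤n⇒m<n∨m≡n q≤q′
  ... | inj₁ (s≤s q≤q′) = Admissible-suc (Admissible-mono q≤q′ adm)
  ... | inj₂ refl       = adm

  count-concatUpTo : ∀ {P : List ℕ → Set} (P? : Decidable P) n f → count P? (concatUpTo n f) ≡ ∑ n (count P? ∘ f)
  count-concatUpTo P? zero    f = refl
  count-concatUpTo P? (suc n) f = trans (count-++ P? (f 0) (concatUpTo n (f ∘ suc))) (cong (count P? (f 0) +_) (count-concatUpTo P? n (f ∘ suc)))

  -- Only the gaps g = 0, g = q and g = i_ℓ - 1 contribute to |𝒫_S(q + 1)|.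
  module PeakCountRecursion {S} (valid : ValidPeakSet S) (q′ : ℕ) (S≤q : All (_≤ suc q′) S) where
    q = suc q′
    M = suc q
    s = length S

    gapCount : ℕ → ℕ
    gapCount g = count (peaks≡? S ∘ insertAt g M) (permutations q)

    peakCount-suc : peakCount S (suc q) ≡ ∑ (suc q) gapCount
    peakCount-suc = trans (count-concatUpTo (peaks≡? S) (suc q) (λ g → map (insertAt g M) (permutations q)))
      (∑-cong (suc q) (λ g _ → count-map (peaks≡? S) (insertAt g M) (permutations q)))

    gapCount-front : gapCount 0 ≡ peakCount (Sℓ S 0) q
    gapCount-front = count-cong _ (peaks≡? (Sℓ S 0)) (permutations q) λ σ σ∈ →
      let open InsertFront σ (permutation-<-suc q σ∈) (s≤s z≤n) in
      ⟦⟧-⇔ _ _ (λ eq → PeakSetIs⇒peaks≡ {σ} (Sℓ-increasing valid 0) (PeakSetIs⁻ S (peaks≡⇒PeakSetIs {π} eq)))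
               (λ eq → PeakSetIs⇒peaks≡ {π} (increasing valid) (PeakSetIs⁺ S (≥1 valid) (peaks≡⇒PeakSetIs {σ} eq)))

    gapCount-back : gapCount q ≡ peakCount S q
    gapCount-back = count-cong _ (peaks≡? S) (permutations q) λ σ σ∈ →
      let open InsertBack σ (permutation-<-suc q σ∈) (s≤s z≤n)
          at-end : ∀ {X} → peaks (insertAt q M σ) ≡ X → peaks π ≡ X
          at-end = subst (λ g → peaks (insertAt g M σ) ≡ _) (sym (permutation-length q σ∈))
      in ⟦⟧-⇔ _ _ (λ eq → PeakSetIs⇒peaks≡ {σ} (increasing valid) (PeakSetIs⁻ S (peaks≡⇒PeakSetIs {π} (at-end eq))))
                  (λ eq → subst (λ g → peaks (insertAt g M σ) ≡ S) (permutation-length q σ∈)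
                            (PeakSetIs⇒peaks≡ {π} (increasing valid) (PeakSetIs⁺ S (peaks≡⇒PeakSetIs {σ} eq))))

    module MiddleGap {G} (G<q′ : G < q′) where
      g = suc G

      g<length : ∀ {σ} → σ ∈ permutations q → g < length σ
      g<length σ∈ = subst (g <_) (sym (permutation-length q σ∈)) (s≤s G<q′)

      gapCount-∉ : suc g ∉ S → gapCount g ≡ 0
      gapCount-∉ g+1∉ = count-none _ (permutations q) λ σ σ∈ eq →
        let open InsertMax σ (ℕₚ.<⇒≤ (g<length σ∈)) (permutation-<-suc q σ∈) (s≤s z≤n)
        in g+1∉ (proj₂ (peaks≡⇒PeakSetIs {π} eq (suc g)) (peak-at (s≤s z≤n) (g<length σ∈)))

      module AtPeak {ℓ} (ℓ<s : ℓ < s) (atℓ : at S ℓ ≡ suc g) where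
        A = take ℓ S
        B = drop (suc ℓ) S

        g+1∈S : suc g ∈ S
        g+1∈S = subst (_∈ S) atℓ (at-∈ S ℓ<s)

        A<g : ∀ {a} → a ∈ A → a < g
        A<g {a} a∈ with ℕₚ.m≤n⇒m<n∨m≡n (ℕₚ.≤-pred (subst (suc a ≤_) atℓ (take<drop (increasing valid) ℕₚ.≤-refl a∈ at∈drop)))
          where at∈drop = subst (at S ℓ ∈_) (sym (drop-at S ℓ<s)) (here refl)
        ... | inj₁ a<g  = a<g
        ... | inj₂ refl = contradiction g+1∈S (¬consecutive valid (∈-take ℓ S a∈))

        g+3≤B : ∀ {b} → b ∈ B → suc (suc (suc g)) ≤ b
        g+3≤B {b} b∈ with ℕₚ.m≤n⇒m<n∨m≡n (subst (_< b) atℓ (take<drop (increasing valid) ℕₚ.≤-refl at∈take b∈))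
          where at∈take = subst (at S ℓ ∈_) (sym (take-suc-at S ℓ<s)) (∈-++⁺ʳ A (here refl))
        ... | inj₁ g+2<b = g+2<b
        ... | inj₂ refl  = contradiction (∈-drop (suc ℓ) S b∈) (¬consecutive valid g+1∈S)

        S≡ : S ≡ A ++ suc g ∷ B
        S≡ = trans (split-at S ℓ<s) (cong (λ x → A ++ x ∷ B) atℓ)

        Sℓ≡ : Sℓ S ℓ ≡ A ++ [ g ] ++ map (_∸ 1) B
        Sℓ≡ = cong (λ xs → A ++ map (_∸ 1) xs) (trans (drop-at S ℓ<s) (cong (_∷ B) atℓ))

        Sℓ+1≡ : Sℓ S (suc ℓ) ≡ A ++ [ suc g ] ++ map (_∸ 1) B
        Sℓ+1≡ = trans (cong (_++ map (_∸ 1) B) (take-suc-at S ℓ<s))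
                  (trans (Listₚ.++-assoc A [ at S ℓ ] (map (_∸ 1) B)) (cong (λ x → A ++ x ∷ map (_∸ 1) B) atℓ))

        module Extension {σ} (σ∈ : σ ∈ permutations q) where
          open InsertMiddle σ (permutation-<-suc q σ∈) (s≤s z≤n) (s≤s z≤n) (g<length σ∈) A B A<g g+3≤B public hiding (S)

          middle-∅ : Middle []
          middle-∅ ()

          middle-g : Middle [ g ]
          middle-g (here refl) = inj₁ refl

          middle-g+1 : Middle [ suc g ]
          middle-g+1 (here refl) = inj₂ refl

          g∉[g+1] : g ∉ [ suc g ]
          g∉[g+1] (here g≡) = ℕₚ.<-irrefl g≡ (ℕₚ.n<1+n g)

          peaks-π≡S : ∀ {X} mid → Middle mid → X ≡ collapse mid → peaks σ ≡ X → peaks π ≡ S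
          peaks-π≡S mid middle X≡ eq = trans (PeakSetIs⇒peaks≡ {π} (subst (Linked _<_) S≡ (increasing valid))
                                                (PeakSetIs⁺ mid middle (peaks≡⇒PeakSetIs {σ} (trans eq X≡)))) (sym S≡)

          peaks-σ≡ : ∀ {X} mid → Middle mid → X ≡ collapse mid → Linked _<_ X →
                     (IsPeak σ g → g ∈ mid) → (IsPeak σ (suc g) → suc g ∈ mid) → (∀ {j} → j ∈ mid → IsPeak σ j) →
                     peaks π ≡ S → peaks σ ≡ X
          peaks-σ≡ mid middle X≡ ↗X peak-g peak-g+1 mid⇒peak eq = PeakSetIs⇒peaks≡ {σ} ↗X
            (subst (PeakSetIs σ) (sym X≡) (PeakSetIs⁻ mid middle peak-g peak-g+1 mid⇒peak (peaks≡⇒PeakSetIs {π} (trans eq S≡))))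

          peaks-σ∈ : peaks π ≡ S → peaks σ ≡ Ŝℓ S ℓ ⊎ peaks σ ≡ Sℓ S ℓ ⊎ peaks σ ≡ Sℓ S (suc ℓ)
          peaks-σ∈ eq with isPeak? σ g | isPeak? σ (suc g)
          ... | yes peak-g | _ = inj₂ (inj₁ (peaks-σ≡ [ g ] middle-g Sℓ≡ (Sℓ-increasing valid ℓ) (λ _ → here refl)
                  (λ peak → contradiction peak (¬consecutive-peaks {σ} peak-g)) (λ { (here refl) → peak-g }) eq))
          ... | no ¬peak-g | yes peak-g+1 = inj₂ (inj₂ (peaks-σ≡ [ suc g ] middle-g+1 Sℓ+1≡ (Sℓ-increasing valid (suc ℓ))
                  (λ peak → contradiction peak ¬peak-g) (λ _ → here refl) (λ { (here refl) → peak-g+1 }) eq))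
          ... | no ¬peak-g | no ¬peak-g+1 = inj₁ (peaks-σ≡ [] middle-∅ refl (Ŝℓ-increasing valid ℓ)
                  (λ peak → contradiction peak ¬peak-g) (λ peak → contradiction peak ¬peak-g+1) (λ ()) eq)

          indicator : ⟦ peaks≡? S (insertAt g M σ) ⟧
                    ≡ ⟦ peaks≡? (Ŝℓ S ℓ) σ ⟧ + ⟦ peaks≡? (Sℓ S ℓ) σ ⟧ + ⟦ peaks≡? (Sℓ S (suc ℓ)) σ ⟧
          indicator = ⟦⟧-⊎₃ (peaks≡? S (insertAt g M σ)) (peaks≡? (Ŝℓ S ℓ) σ) (peaks≡? (Sℓ S ℓ) σ) (peaks≡? (Sℓ S (suc ℓ)) σ)
            peaks-σ∈ (peaks-π≡S [] middle-∅ refl) (peaks-π≡S [ g ] middle-g Sℓ≡) (peaks-π≡S [ suc g ] middle-g+1 Sℓ+1≡)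
            (λ e₁ e₂ → collapse-≢ middle-∅ ℕₚ.≤-refl (ℕₚ.n≤1+n g) (here refl) (λ ()) (trans (sym Sℓ≡) (trans (sym e₂) e₁)))
            (λ e₁ e₃ → collapse-≢ middle-∅ (ℕₚ.n≤1+n g) ℕₚ.≤-refl (here refl) (λ ()) (trans (sym Sℓ+1≡) (trans (sym e₃) e₁)))
            (λ e₂ e₃ → collapse-≢ middle-g+1 ℕₚ.≤-refl (ℕₚ.n≤1+n g) (here refl) g∉[g+1]
                         (trans (sym Sℓ≡) (trans (sym e₂) (trans e₃ Sℓ+1≡))))

        gapCount-∈ : gapCount g ≡ peakCount (Ŝℓ S ℓ) q + peakCount (Sℓ S ℓ) q + peakCount (Sℓ S (suc ℓ)) q
        gapCount-∈ = count-+₃ _ (peaks≡? (Ŝℓ S ℓ)) (peaks≡? (Sℓ S ℓ)) (peaks≡? (Sℓ S (suc ℓ))) (permutations q)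
                       (λ σ σ∈ → Extension.indicator σ∈)

    F H Y : ℕ → ℕ
    F ℓ = peakCount (Sℓ S ℓ) q
    H ℓ = peakCount (Ŝℓ S ℓ) q
    Y ℓ = H ℓ + F ℓ + F (suc ℓ)

    gapCount-middle : ∀ G → G < q′ → gapCount (suc G) ≡ ∑ s (λ ℓ → δ (at S ℓ) (suc (suc G)) (Y ℓ))
    gapCount-middle G G<q′ with suc (suc G) ∈? S
    ... | no ∉S = trans (MiddleGap.gapCount-∉ G<q′ ∉S)
                        (sym (∑-zero s (λ ℓ ℓ<s → δ-≢ (Y ℓ) (λ at≡ → ∉S (subst (_∈ S) at≡ (at-∈ S ℓ<s))))))
    ... | yes ∈S with ∈⇒at S ∈S
    ...   | ℓ₀ , ℓ₀<s , atℓ₀ = trans (MiddleGap.AtPeak.gapCount-∈ G<q′ ℓ₀<s atℓ₀)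
                                     (sym (trans (∑-cong s select) (∑-δ s ℓ₀ Y ℓ₀<s)))
      where
      select : ∀ ℓ → ℓ < s → δ (at S ℓ) (suc (suc G)) (Y ℓ) ≡ δ ℓ ℓ₀ (Y ℓ)
      select ℓ ℓ<s = by-cases (ℓ ℕₚ.≟ ℓ₀)
        where
        by-cases : Dec (ℓ ≡ ℓ₀) → δ (at S ℓ) (suc (suc G)) (Y ℓ) ≡ δ ℓ ℓ₀ (Y ℓ)
        by-cases (yes refl) = trans (δ-≡ (Y ℓ) atℓ₀) (sym (δ-≡ (Y ℓ) refl))
        by-cases (no ℓ≢ℓ₀)  = trans (δ-≢ (Y ℓ) (ℓ≢ℓ₀ ∘ λ at≡ → at-injective (increasing valid) ℓ<s ℓ₀<s (trans at≡ (sym atℓ₀))))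
                                    (sym (δ-≢ (Y ℓ) ℓ≢ℓ₀))

    -- Each i_ℓ = v + 2 is met by exactly one middle gap G + 1, namely G = v < q′.
    gap-of-peak : ∀ ℓ → ℓ < s → ∑ q′ (λ G → δ (at S ℓ) (suc (suc G)) (Y ℓ)) ≡ Y ℓ
    gap-of-peak ℓ ℓ<s with at S ℓ | All.lookup (≥2 valid) (at-∈ S ℓ<s) | All.lookup S≤q (at-∈ S ℓ<s)
    ... | suc (suc v) | s≤s (s≤s z≤n) | s≤s v<q′ =
      trans (∑-cong q′ (λ G _ → trans (δ-suc (suc v) (suc G) (Y ℓ)) (trans (δ-suc v G (Y ℓ)) (δ-sym v G (Y ℓ)))))
            (∑-δ q′ v (λ _ → Y ℓ) v<q′)

    ∑-middle-gaps : ∑ q′ (gapCount ∘ suc) ≡ ∑ s Y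
    ∑-middle-gaps = begin
      ∑ q′ (gapCount ∘ suc)                                       ≡⟨ ∑-cong q′ gapCount-middle ⟩
      ∑ q′ (λ G → ∑ s (λ ℓ → δ (at S ℓ) (suc (suc G)) (Y ℓ)))    ≡⟨ ∑-swap q′ s (λ G ℓ → δ (at S ℓ) (suc (suc G)) (Y ℓ)) ⟩
      ∑ s (λ ℓ → ∑ q′ (λ G → δ (at S ℓ) (suc (suc G)) (Y ℓ)))    ≡⟨ ∑-cong s gap-of-peak ⟩
      ∑ s Y                                                       ∎
      where open ≡-Reasoning

    F-last : F s ≡ peakCount S q
    F-last = cong (λ T → peakCount T q)
      (trans (cong₂ (λ xs ys → xs ++ map (_∸ 1) ys) (Listₚ.take-all s S ℕₚ.≤-refl) (Listₚ.drop-all s S ℕₚ.≤-refl))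
             (Listₚ.++-identityʳ S))

    peakCount-recursion : peakCount S (suc q) ≡ (peakCount S q + peakCount S q) + (∑ s F + ∑ s F) + ∑ s H
    peakCount-recursion = begin
      peakCount S (suc q)                                ≡⟨ peakCount-suc ⟩
      gapCount 0 + ∑ q (gapCount ∘ suc)                  ≡⟨ cong (gapCount 0 +_) (∑-last q′ (gapCount ∘ suc)) ⟩
      gapCount 0 + (∑ q′ (gapCount ∘ suc) + gapCount q)  ≡⟨ cong₂ (λ a b → a + (b + gapCount q)) gapCount-front ∑-middle-gaps ⟩
      F 0 + (∑ s Y + gapCount q)                         ≡⟨ cong₂ (λ a b → F 0 + (a + b)) ∑Y gapCount-back ⟩
      F 0 + (∑ s H + ∑ s F + ∑ s (F ∘ suc) + N)          ≡⟨ regroup (F 0) (∑ s H) (∑ s F) (∑ s (F ∘ suc)) N ⟩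
      (F 0 + ∑ s (F ∘ suc)) + ∑ s H + ∑ s F + N          ≡⟨ cong (λ t → t + ∑ s H + ∑ s F + N) (trans (∑-last s F) (cong (∑ s F +_) F-last)) ⟩
      (∑ s F + N) + ∑ s H + ∑ s F + N                    ≡⟨ collect (∑ s F) N (∑ s H) ⟩
      (N + N) + (∑ s F + ∑ s F) + ∑ s H                  ∎
      where
      open ≡-Reasoning
      N = peakCount S q
      ∑Y : ∑ s Y ≡ ∑ s H + ∑ s F + ∑ s (F ∘ suc)
      ∑Y = trans (∑-+ s (λ ℓ → H ℓ + F ℓ) (F ∘ suc)) (cong (_+ ∑ s (F ∘ suc)) (∑-+ s H F))
      regroup : ∀ a h f f′ n → a + (h + f + f′ + n) ≡ (a + f′) + h + f + n
      regroup = solve-∀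
      collect : ∀ f n h → (f + n) + h + f + n ≡ (n + n) + (f + f) + h
      collect = solve-∀


open import Data.Nat as ℕ using (ℕ; zero; suc; _∸_; _^_; _<_; _≤_; z≤n; s≤s)
import Data.Nat.Properties as ℕₚ
open import Data.Rational as ℚ using (ℚ; 0ℚ; 1ℚ; _+_; _*_; _-_)
import Data.Rational.Properties as ℚₚ
open import Data.List using (List; length)
open import Data.List.Relation.Unary.All as All using (All)
open import Data.List.Relation.Unary.Linked using (Linked)
open import Data.Product using (∃; _×_; _,_; proj₁; proj₂)
open import Effect.Monad using (RawMonad)
open import Function using (_∘_)
open import Level using (0ℓ)
open import Relation.Binary.PropositionalEquality
open import Relation.Nullary using (¬_; Dec; yes; no)
open import Relation.Nullary.Decidable using (decidable-stable; ¬¬-excluded-middle)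
open import Relation.Nullary.Negation using (¬¬-Monad; ¬¬-map)
open import Tactic.RingSolver using (solve-∀)
open import Defs
open Polynomial
open Counting using (∑)
open PeakCounts

suc-∸-∸1 : ∀ {q s} → s < q → suc q ∸ s ∸ 1 ≡ suc (q ∸ s ∸ 1)
suc-∸-∸1 {suc q} {zero}  _         = refl
suc-∸-∸1 {suc q} {suc s} (s≤s s<q) = suc-∸-∸1 s<q

Eventually : (ℕ → Set) → Set
Eventually P = ∃ λ Q → ∀ q → Q ≤ q → P q

Eventually-× : ∀ {P R} → Eventually P → Eventually R → Eventually (λ q → P q × R q)
Eventually-× (Q , P-from) (Q′ , R-from) = Q ℕ.+ Q′ , λ q Q+Q′≤q →
  P-from q (ℕₚ.≤-trans (ℕₚ.m≤m+n Q Q′) Q+Q′≤q) , R-from q (ℕₚ.≤-trans (ℕₚ.m≤n+m Q′ Q) Q+Q′≤q)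

open RawMonad (¬¬-Monad {a = 0ℓ})

¬¬Eventually-∀< : ∀ s {P : ℕ → ℕ → Set} → (∀ ℓ → ℓ < s → ¬ ¬ Eventually (P ℓ)) →
                  ¬ ¬ Eventually (λ q → ∀ ℓ → ℓ < s → P ℓ q)
¬¬Eventually-∀< zero    _  = pure (0 , λ _ _ _ ())
¬¬Eventually-∀< (suc s) ev = do
  first ← ev 0 (s≤s z≤n)
  rest  ← ¬¬Eventually-∀< s (λ ℓ ℓ<s → ev (suc ℓ) (s≤s ℓ<s))
  pure (let Q , both = Eventually-× first rest in
        Q , λ { q Q≤q zero    _         → proj₁ (both q Q≤q)
              ; q Q≤q (suc ℓ) (s≤s ℓ<s) → proj₂ (both q Q≤q) ℓ ℓ<s })

CountFormula : List ℕ → Poly → ℕ → Set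
CountFormula T P q = ℕ→ℚ (peakCount T q) ≡ eval P (ℕ→ℚ q) * ℕ→ℚ (2 ^ (q ∸ length T ∸ 1))

¬¬CountFormula : ∀ {T P} → Linked _<_ T → IsPeakPoly T P → ¬ ¬ Eventually (CountFormula T P)
¬¬CountFormula {T} {P} ↗T (formula , vanishes) = do
  admissible? ← ¬¬-excluded-middle
  pure (by-cases admissible?)
  where
  by-cases : Dec (∃ (Admissible T)) → Eventually (CountFormula T P)
  by-cases (yes (q₀ , adm)) = q₀ , λ q q₀≤q → formula q _ (Admissible-mono q₀≤q adm) (peakCount-HasCount q ↗T)
  by-cases (no ¬adm) = 0 , λ q _ → begin
    ℕ→ℚ (peakCount T q)                      ≡⟨ cong ℕ→ℚ (peakCount-¬Admissible q (¬adm ∘ (q ,_))) ⟩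
    0ℚ                                       ≡⟨ ℚₚ.*-zeroˡ (ℕ→ℚ (2 ^ (q ∸ length T ∸ 1))) ⟨
    0ℚ * ℕ→ℚ (2 ^ (q ∸ length T ∸ 1))        ≡⟨ cong (_* ℕ→ℚ (2 ^ (q ∸ length T ∸ 1))) (vanishes (λ q adm → ¬adm (q , adm)) (ℕ→ℚ q)) ⟨
    eval P (ℕ→ℚ q) * ℕ→ℚ (2 ^ (q ∸ length T ∸ 1)) ∎
    where open ≡-Reasoning

module DifferenceEquation (p : List ℕ → Poly) (isPeakPoly : ∀ T → Linked _<_ T → IsPeakPoly T (p T))
                          {n S} (↗S : Linked _<_ S) (adm : Admissible S (suc n)) where
  valid : ValidPeakSet S
  valid = proj₁ (Admissible⇒valid ↗S adm)

  s = length S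

  Formulas : ℕ → Set
  Formulas q = CountFormula S (p S) q
             × (∀ ℓ → ℓ < s → CountFormula (Sℓ S ℓ) (p (Sℓ S ℓ)) q)
             × (∀ ℓ → ℓ < s → CountFormula (Ŝℓ S ℓ) (p (Ŝℓ S ℓ)) q)

  ¬¬Formula : ∀ {T} → Linked _<_ T → ¬ ¬ Eventually (CountFormula T (p T))
  ¬¬Formula {T} ↗T = ¬¬CountFormula {P = p T} ↗T (isPeakPoly T ↗T)

  ¬¬Formulas : ¬ ¬ Eventually Formulas
  ¬¬Formulas = do
    formula  ← ¬¬Formula ↗S
    formulaℓ ← ¬¬Eventually-∀< s {λ ℓ → CountFormula (Sℓ S ℓ) (p (Sℓ S ℓ))} (λ ℓ _ → ¬¬Formula (Sℓ-increasing valid ℓ))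
    formulâℓ ← ¬¬Eventually-∀< s {λ ℓ → CountFormula (Ŝℓ S ℓ) (p (Ŝℓ S ℓ))} (λ ℓ _ → ¬¬Formula (Ŝℓ-increasing valid ℓ))
    pure (Eventually-× formula (Eventually-× formulaℓ formulâℓ))

  C Ĉ : ℚ → ℚ
  C x = sumℚ s (λ ℓ → eval (p (Sℓ S ℓ)) x)
  Ĉ x = sumℚ s (λ ℓ → eval (p (Ŝℓ S ℓ)) x)

  -- The count recursion, divided by 2^(q - s) = E + E.
  step : ∀ q′ → n ≤ q′ → s < suc q′ → Formulas (suc q′) → CountFormula S (p S) (suc (suc q′)) →
         eval (p S) (ℕ→ℚ (suc (suc q′))) ≡ eval (p S) (ℕ→ℚ (suc q′)) + (C (ℕ→ℚ (suc q′)) + Ĉ (ℕ→ℚ (suc q′)))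
  step q′ n≤q′ s<q (formula , formulaℓ , formulâℓ) formula′ =
    *-cancelˡ-≢0 (E + E) (ℕ→ℚ-2^≢0 (suc (q ∸ s ∸ 1)) ∘ trans (ℕ→ℚ-2^-suc (q ∸ s ∸ 1))) scaled
    where
    q = suc q′
    open PeakCountRecursion valid q′ (All.map (λ x≤ → ℕₚ.≤-trans x≤ (s≤s n≤q′)) (proj₂ (Admissible⇒valid ↗S adm)))
      using (peakCount-recursion; F; H)
    E  = ℕ→ℚ (2 ^ (q ∸ s ∸ 1))
    N  = peakCount S q
    A  = eval (p S) (ℕ→ℚ (suc q))
    B  = eval (p S) (ℕ→ℚ q)
    Cq = C (ℕ→ℚ q)
    Ĉq = Ĉ (ℕ→ℚ q)

    E+E : ℕ→ℚ (2 ^ (suc q ∸ s ∸ 1)) ≡ E + E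
    E+E = trans (cong (ℕ→ℚ ∘ (2 ^_)) (suc-∸-∸1 s<q)) (ℕ→ℚ-2^-suc (q ∸ s ∸ 1))

    ∑F : ℕ→ℚ (∑ s F) ≡ Cq * E
    ∑F = trans (ℕ→ℚ-∑ s F) (trans (sumℚ-cong s (λ ℓ ℓ<s → trans (formulaℓ ℓ ℓ<s)
                 (cong (λ t → eval (p (Sℓ S ℓ)) (ℕ→ℚ q) * ℕ→ℚ (2 ^ (q ∸ t ∸ 1))) (length-Sℓ S ℓ))))
               (sumℚ-*ʳ s (λ ℓ → eval (p (Sℓ S ℓ)) (ℕ→ℚ q)) E))

    ∑H : ℕ→ℚ (∑ s H) ≡ Ĉq * (E + E)
    ∑H = trans (ℕ→ℚ-∑ s H) (trans (sumℚ-cong s (λ ℓ ℓ<s → trans (formulâℓ ℓ ℓ<s)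
                 (cong (eval (p (Ŝℓ S ℓ)) (ℕ→ℚ q) *_)
                   (trans (cong (λ t → ℕ→ℚ (2 ^ (suc q ∸ t ∸ 1))) (length-Ŝℓ S ℓ<s)) E+E))))
               (sumℚ-*ʳ s (λ ℓ → eval (p (Ŝℓ S ℓ)) (ℕ→ℚ q)) (E + E)))

    cast : ∀ a b c → ℕ→ℚ ((a ℕ.+ a) ℕ.+ (b ℕ.+ b) ℕ.+ c) ≡ (ℕ→ℚ a + ℕ→ℚ a) + (ℕ→ℚ b + ℕ→ℚ b) + ℕ→ℚ c
    cast a b c = trans (ℕ→ℚ-+ ((a ℕ.+ a) ℕ.+ (b ℕ.+ b)) c)
      (cong (_+ ℕ→ℚ c) (trans (ℕ→ℚ-+ (a ℕ.+ a) (b ℕ.+ b)) (cong₂ _+_ (ℕ→ℚ-+ a a) (ℕ→ℚ-+ b b))))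

    factor : ∀ b c h E → (b * E + b * E) + (c * E + c * E) + h * (E + E) ≡ (E + E) * (b + (c + h))
    factor = solve-∀ ℚ-ring

    scaled : (E + E) * A ≡ (E + E) * (B + (Cq + Ĉq))
    scaled = begin
      (E + E) * A                                                     ≡⟨ ℚₚ.*-comm (E + E) A ⟩
      A * (E + E)                                                     ≡⟨ cong (A *_) E+E ⟨
      A * ℕ→ℚ (2 ^ (suc q ∸ s ∸ 1))                                   ≡⟨ formula′ ⟨
      ℕ→ℚ (peakCount S (suc q))                                       ≡⟨ cong ℕ→ℚ peakCount-recursion ⟩
      ℕ→ℚ ((N ℕ.+ N) ℕ.+ (∑ s F ℕ.+ ∑ s F) ℕ.+ ∑ s H)                 ≡⟨ cast N (∑ s F) (∑ s H) ⟩
      (ℕ→ℚ N + ℕ→ℚ N) + (ℕ→ℚ (∑ s F) + ℕ→ℚ (∑ s F)) + ℕ→ℚ (∑ s H)   ≡⟨ plug formula ∑F ∑H ⟩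
      (B * E + B * E) + (Cq * E + Cq * E) + Ĉq * (E + E)              ≡⟨ factor B Cq Ĉq E ⟩
      (E + E) * (B + (Cq + Ĉq))                                       ∎
      where
      open ≡-Reasoning
      plug : ∀ {u u′ v v′ w w′} → u ≡ u′ → v ≡ v′ → w ≡ w′ → (u + u) + (v + v) + w ≡ (u′ + u′) + (v′ + v′) + w′
      plug refl refl refl = refl

  Δ-identity : Eventually Formulas → ∀ x → Δeval (p S) x ≡ C x + Ĉ x
  Δ-identity (Q , formulas) x = begin
    eval (p S) (x + 1ℚ) - eval (p S) x                ≡⟨ cong (_- eval (p S) x) (eval-shift (p S) x) ⟨
    eval (shift (p S)) x - eval (p S) x               ≡⟨ cong (_- eval (p S) x) (eventually-equal⇒equal (shift (p S)) RHS Q₀ agree x) ⟩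
    eval RHS x - eval (p S) x                         ≡⟨ cong (_- eval (p S) x) (eval-RHS x) ⟩
    eval (p S) x + (C x + Ĉ x) - eval (p S) x         ≡⟨ cancel (eval (p S) x) (C x + Ĉ x) ⟩
    C x + Ĉ x                                         ∎
    where
    open ≡-Reasoning
    RHS = p S ⊕ (∑ₚ s (p ∘ Sℓ S) ⊕ ∑ₚ s (p ∘ Ŝℓ S))
    Q₀  = suc (Q ℕ.+ n ℕ.+ s)

    eval-RHS : ∀ y → eval RHS y ≡ eval (p S) y + (C y + Ĉ y)
    eval-RHS y = trans (eval-⊕ (p S) _ y) (cong (eval (p S) y +_)
      (trans (eval-⊕ (∑ₚ s (p ∘ Sℓ S)) _ y) (cong₂ _+_ (eval-∑ₚ s (p ∘ Sℓ S) y) (eval-∑ₚ s (p ∘ Ŝℓ S) y))))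

    cancel : ∀ a c → a + c - a ≡ c
    cancel = solve-∀ ℚ-ring

    agree : ∀ q → Q₀ ≤ q → eval (shift (p S)) (ℕ→ℚ q) ≡ eval RHS (ℕ→ℚ q)
    agree (suc q′) (s≤s large) = begin
      eval (shift (p S)) (ℕ→ℚ (suc q′))                 ≡⟨ eval-shift (p S) (ℕ→ℚ (suc q′)) ⟩
      eval (p S) (ℕ→ℚ (suc q′) + 1ℚ)                    ≡⟨ cong (eval (p S)) (trans (ℚₚ.+-comm (ℕ→ℚ (suc q′)) 1ℚ) (sym (ℕ→ℚ-suc (suc q′)))) ⟩
      eval (p S) (ℕ→ℚ (suc (suc q′)))                   ≡⟨ step q′ n≤q′ (s≤s s≤q′) (formulas (suc q′) (ℕₚ.m≤n⇒m≤1+n Q≤q′))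
                                                              (proj₁ (formulas (suc (suc q′)) (ℕₚ.m≤n⇒m≤1+n (ℕₚ.m≤n⇒m≤1+n Q≤q′)))) ⟩
      eval (p S) (ℕ→ℚ (suc q′)) + (C (ℕ→ℚ (suc q′)) + Ĉ (ℕ→ℚ (suc q′))) ≡⟨ eval-RHS (ℕ→ℚ (suc q′)) ⟨
      eval RHS (ℕ→ℚ (suc q′))                           ∎
      where
      Q≤q′ = ℕₚ.≤-trans (ℕₚ.≤-trans (ℕₚ.m≤m+n Q n) (ℕₚ.m≤m+n (Q ℕ.+ n) s)) large
      n≤q′ = ℕₚ.≤-trans (ℕₚ.≤-trans (ℕₚ.m≤n+m n Q) (ℕₚ.m≤m+n (Q ℕ.+ n) s)) large
      s≤q′ = ℕₚ.≤-trans (ℕₚ.m≤n+m s (Q ℕ.+ n)) large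

corollary3 : (p : List ℕ → Poly) → (∀ T → Linked _<_ T → IsPeakPoly T (p T)) →
    (n : ℕ) (S : List ℕ) → Linked _<_ S → Admissible S (suc n) →
    ∀ x → Δeval (p S) x
          ≡ sumℚ (length S) (λ ℓ → eval (p (Sℓ S ℓ)) x)
            + sumℚ (length S) (λ ℓ → eval (p (Ŝℓ S ℓ)) x)
corollary3 p isPeakPoly n S ↗S adm x =
  decidable-stable (Δeval (p S) x ℚ.≟ _) (¬¬-map (λ formulas → Δ-identity formulas x) ¬¬Formulas)
  where open DifferenceEquation p isPeakPoly ↗S adm
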